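{- Let $\mathcal{M}$ be a finite unitary magma. Then the operad $\mathrm{NC}\mathcal{M}$ admits the presentation $(\mathcal{T}_\mathcal{M}, \mathfrak{R}_{\mathrm{NC}\mathcal{M}})$, that is, $\mathrm{NC}\mathcal{M}$ is isomorphic to the quotient operad $\mathrm{Free}(\mathbb{K}\langle \mathcal{T}_\mathcal{M}\rangle)/\langle \mathfrak{R}_{\mathrm{NC}\mathcal{M}}\rangle$, where $\mathfrak{R}_{\mathrm{NC}\mathcal{M}}$ is the subspace of $\mathrm{Free}(\mathbb{K}\langle \mathcal{T}_\mathcal{M}\rangle)(3)$ spanned by all elements (1) $\mathrm{T}(p_0,p_1,p_2)\circ_1 \mathrm{T}(q_0,q_1,q_2) - \mathrm{T}(p_0,r_1,p_2)\circ_1\mathrm{T}(r_0,q_1,q_2)$ whenever $p_1\star q_0 = r_1\star r_0 \neq 1_\mathcal{M}$; (2) $\mathrm{T}(p_0,p_1,p_2)\circ_1 \mathrm{T}(q_0,q_1,q_2) - \mathrm{T}(p_0,q_1,r_2)\circ_2\mathrm{T}(r_0,q_2,p_2)$ whenever $p_1\star q_0 = r_2\star r_0 = 1_\mathcal{M}$; (3) $\mathrm{T}(p_0,p_1,p_2)\circ_2 \mathrm{T}(q_0,q_1,q_2) - \mathrm{T}(p_0,p_1,r_2)\circ_2\mathrm{T}(r_0,q_1,q_2)$ whenever $p_2\star q_0 = r_2\star r_0 \neq 1_\mathcal{M}$; where all $p_j,q_j,r_j$ range over $\mathcal{M}$, and $\langle \mathfrak{R}_{\mathrm{NC}\mathcal{M}}\rangle$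 denotes the operad ideal generated by $\mathfrak{R}_{\mathrm{NC}\mathcal{M}}$.
   Context: $\mathbb{K}$ is a field of characteristic zero. A unitary magma $\mathcal{M}$ is a set with a binary operation $\star$ admitting a two-sided unit $1_\mathcal{M}$. For $n\ge 1$, an $\mathcal{M}$-clique of arity $n$ is a labeling $\mathfrak{p}$ assigning to each arc $(x,y)$, $1\le x<y\le n+1$, of a polygon with vertices $1,\dots,n+1$ an element $\mathfrak{p}(x,y)\in\mathcal{M}$; the arc $(1,n+1)$ is the base, the arcs $(i,i+1)$, $i\in[n]$, are the edges, the others are diagonals; write $\mathfrak{p}_0:=\mathfrak{p}(1,n+1)$ and $\mathfrak{p}_i:=\mathfrak{p}(i,i+1)$. By convention there is exactly one $\mathcal{M}$-clique of arity $1$ (the unit). An arc is solid if its label differs from $1_\mathcal{M}$. Diagonals $(x,y),(x',y')$ cross if $x<x'<y<y'$ or $x'<x<y'<y$; an $\mathcal{M}$-clique is noncrossing if no two solid diagonals cross. For $\mathfrak{p}$ of arity $n$, $\mathfrak{q}$ of arity $m$ and $i\in[n]$, the partial composition $\mathfrak{p}\circ_i\mathfrak{q}$ is the $\mathcal{M}$-clique $\mathfrak{r}$ of arity $n+m-1$ obtained by gluing the base of $\mathfrak{q}$ onto the $i$th edge of $\mathfrak{p}$: with $\varphi(x)=x$ for $x\le i$ and $\varphi(x)=x+m-1$ for $x>i$, one sets $\mathfrak{r}(\varphi(x),\varphi(y))=\mathfrak{p}(x,y)$ for arcs $(x,y)\neq(i,i+1)$ of $\mathfrak{p}$, $\mathfrak{r}(x+i-1,y+i-1)=\mathfrak{q}(x,y)$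 for arcs $(x,y)\neq(1,m+1)$ of $\mathfrak{q}$, $\mathfrak{r}(i,i+m)=\mathfrak{p}_i\star\mathfrak{q}_0$, and all other arcs of $\mathfrak{r}$ are labeled $1_\mathcal{M}$. The linear span of all $\mathcal{M}$-cliques with these compositions (and the arity-1 clique as unit) is an operad $\mathsf{C}\mathcal{M}$; $\mathrm{NC}\mathcal{M}$ is its suboperad spanned by noncrossing $\mathcal{M}$-cliques. An $\mathcal{M}$-triangle is an $\mathcal{M}$-clique of arity $2$; $\mathcal{T}_\mathcal{M}$ is the set of $\mathcal{M}$-triangles, and $\mathrm{T}(a,b,c)$ denotes the triangle with base labeled $a$, first edge $b$, second edge $c$. $\mathrm{Free}(\mathbb{K}\langle\mathcal{T}_\mathcal{M}\rangle)$ is the free (nonsymmetric) operad on the generators $\mathcal{T}_\mathcal{M}$ (of arity $2$), with basis the syntax trees whose internal nodes are labeled by $\mathcal{M}$-triangles; $\mathrm{T}(\cdot)\circ_i\mathrm{T}(\cdot)$ denotes the corresponding degree-2 syntax tree. -}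

module Defs where

open import Level using (Level; _⊔_) renaming (suc to lsuc)
open import Data.Nat using (ℕ; zero; suc; _+_; _∸_; _<_; _≤_; _≤ᵇ_; _<ᵇ_; _≡ᵇ_)
open import Data.Nat.Properties using (allUpTo?)
open import Data.Fin using (Fin)
import Data.Fin.Properties as FinP
open import Data.Bool using (Bool; true; false; if_then_else_; _∧_)
open import Data.Product using (Σ; ∃; _×_; _,_; proj₁; proj₂)
open import Data.Sum using (_⊎_)
open import Data.List using (List; []; _∷_; _++_; map)
open import Data.List.Relation.Unary.All using (All)
open import Relation.Binary.PropositionalEquality using (_≡_; refl; cong; cong₂)
open import Relation.Nullary using (¬_; Dec; yes; no)
open import Relation.Nullary.Decidable using (does)
open import Algebra.Bundles using (CommutativeRing)

record Field (c ℓ : Level) : Set (lsuc (c ⊔ ℓ)) where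
  field
    commutativeRing : CommutativeRing c ℓ
  open CommutativeRing commutativeRing public
  field
    0≉1     : ¬ (0# ≈ 1#)
    inverse : ∀ x → ¬ (x ≈ 0#) → ∃ λ y → (x * y) ≈ 1#

fromℕ : ∀ {c ℓ} (K : Field c ℓ) → ℕ → Field.Carrier K
fromℕ K zero    = Field.0# K
fromℕ K (suc n) = Field._+_ K (Field.1# K) (fromℕ K n)

CharacteristicZero : ∀ {c ℓ} → Field c ℓ → Set ℓ
CharacteristicZero K = ∀ n → Field._≈_ K (fromℕ K (suc n)) (Field.0# K) → Data.Empty.⊥
  where import Data.Empty

-- Finite unitary magmas: carrier Fin size (any finite set, up to bijection)

record FiniteUnitaryMagma : Set where
  field
    size      : ℕ
    _⋆_       : Fin size → Fin size → Fin size
    𝟙         : Fin size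
    identityˡ : ∀ x → 𝟙 ⋆ x ≡ x
    identityʳ : ∀ x → x ⋆ 𝟙 ≡ x

module NC {c ℓ} (K : Field c ℓ) (M : FiniteUnitaryMagma) where
  open FiniteUnitaryMagma M public
  open Field K public using (_≈_; 0#; 1#)
  open Field K using (-_) renaming (Carrier to 𝕂; _+_ to _+K_; _*_ to _*K_)

  Elt : Set
  Elt = Fin size

  -- An M-clique of arity n: vertices 0,1,...,n (the paper's 1,...,n+1
  -- shifted by one); the label of the arc (x , y), x < y ≤ n, is  p x y.
  -- Values of p outside the arcs are irrelevant (see _≐[_]_ below).
  -- Base = (0 , n), edges = (i , i+1), diagonals = the other arcs.
  Clique : Set
  Clique = ℕ → ℕ → Elt

  _≐[_]_ : Clique → ℕ → Clique → Set
  p ≐[ n ] q = ∀ {y} → y < suc n → ∀ {x} → x < y → p x y ≡ q x y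

  _≐?[_]_ : ∀ p n q → Dec (p ≐[ n ] q)
  p ≐?[ n ] q = allUpTo? (λ y → allUpTo? (λ x → p x y FinP.≟ q x y) y) (suc n)

  Diagonal : ℕ → ℕ → ℕ → Set
  Diagonal n x y = x < y × y ≤ n × ¬ (suc x ≡ y) × ¬ ((x ≡ 0) × (y ≡ n))

  Solid : Clique → ℕ → ℕ → Set
  Solid p x y = ¬ (p x y ≡ 𝟙)

  Cross : ℕ → ℕ → ℕ → ℕ → Set
  Cross x y x′ y′ = (x < x′ × x′ < y × y < y′) ⊎ (x′ < x × x < y′ × y′ < y)

  NonCrossing : ℕ → Clique → Set
  NonCrossing n p = ∀ x y x′ y′ → Diagonal n x y → Diagonal n x′ y′ →
                    Solid p x y → Solid p x′ y′ → ¬ Cross x y x′ y′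

  -- the unique clique of arity 1 (the unit): its single arc is labelled 𝟙
  IsNCClique : ℕ → Clique → Set
  IsNCClique n p = (n ≡ 1 → p 0 1 ≡ 𝟙) × NonCrossing n p

  unitC : Clique
  unitC _ _ = 𝟙

  -- partial composition  p ∘ q  gluing the base of q (arity m) on the
  -- edge (j , j+1) of p (0-based edge index j)
  compC : Clique → ℕ → ℕ → Clique → Clique
  compC p j m q x y =
    if (j ≤ᵇ x) ∧ (y ≤ᵇ j + m)
    then (if (x ≡ᵇ j) ∧ (y ≡ᵇ j + m) then (p j (suc j) ⋆ q 0 m) else q (x ∸ j) (y ∸ j))
    else (if inImg x ∧ inImg y then p (back x) (back y) else 𝟙)
    where
    inImg : ℕ → Bool
    inImg z = (z ≤ᵇ j) Data.Bool.∨ ((j + m) ≤ᵇ z)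
    back : ℕ → ℕ
    back z = if z ≤ᵇ j then z else (z + 1) ∸ m

  -- M-triangles  T(a,b,c): base a, first edge b, second edge c
  Triangle : Set
  Triangle = Elt × Elt × Elt

  triC : Triangle → Clique
  triC (a , b , c) x y =
    if (x ≡ᵇ 0) ∧ (y ≡ᵇ 2) then a else
    if (x ≡ᵇ 0) ∧ (y ≡ᵇ 1) then b else
    if (x ≡ᵇ 1) ∧ (y ≡ᵇ 2) then c else 𝟙

  -- syntax trees of the free operad on T_M (binary nodes labelled by triangles)
  data Tree : Set where
    leaf : Tree
    node : Triangle → Tree → Tree → Tree

  arity : Tree → ℕ
  arity leaf         = 1
  arity (node _ l r) = arity l + arity r

  -- partial composition of syntax trees: s grafted on leaf i (0-based) of t
  graft : Tree → ℕ → Tree → Tree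
  graft leaf zero s = s
  graft leaf (suc _) s = leaf
  graft (node T l r) i s =
    if i <ᵇ arity l then node T (graft l i s) r else node T l (graft r (i ∸ arity l) s)

  _≟T_ : (s t : Tree) → Dec (s ≡ t)
  leaf ≟T leaf = yes refl
  leaf ≟T node _ _ _ = no λ ()
  node _ _ _ ≟T leaf = no λ ()
  node (a , b , c) l r ≟T node (a′ , b′ , c′) l′ r′
    with a FinP.≟ a′ | b FinP.≟ b′ | c FinP.≟ c′ | l ≟T l′ | r ≟T r′
  ... | yes refl | yes refl | yes refl | yes refl | yes refl = yes refl
  ... | no ne | _ | _ | _ | _ = no λ { refl → ne refl }
  ... | yes _ | no ne | _ | _ | _ = no λ { refl → ne refl }
  ... | yes _ | yes _ | no ne | _ | _ = no λ { refl → ne refl }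
  ... | yes _ | yes _ | yes _ | no ne | _ = no λ { refl → ne refl }
  ... | yes _ | yes _ | yes _ | yes _ | no ne = no λ { refl → ne refl }

  -- the operad morphism Free(K⟨T_M⟩) → C M sending T to its triangle
  ev : Tree → Clique
  ev leaf = unitC
  ev (node T l r) = compC (compC (triC T) 0 (arity l) (ev l)) (arity l) (arity r) (ev r)

  -- elements of Free(K⟨T_M⟩): finite formal K-linear combinations of trees
  Comb : Set c
  Comb = List (𝕂 × Tree)

  Homogeneous : ℕ → Comb → Set c
  Homogeneous n x = All (λ at → arity (proj₂ at) ≡ n) x

  sumK : List 𝕂 → 𝕂
  sumK [] = 0#
  sumK (a ∷ as) = a +K sumK as

  coeffT : Tree → Comb → 𝕂
  coeffT t x = sumK (map (λ at → if does (proj₂ at ≟T t) then proj₁ at else 0#) x)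

  _≈F_ : Comb → Comb → Set ℓ
  x ≈F y = ∀ t → coeffT t x ≈ coeffT t y

  -- coefficient of the clique p (of arity n) in the image of x in NC M
  coeffC : ℕ → Clique → Comb → 𝕂
  coeffC n p x = sumK (map (λ at → if does (ev (proj₂ at) ≐?[ n ] p) then proj₁ at else 0#) x)

  scaleF : 𝕂 → Comb → Comb
  scaleF k = map (λ at → (k *K proj₁ at , proj₂ at))

  _∘₁_ : Triangle → Triangle → Tree
  p ∘₁ q = node p (node q leaf leaf) leaf

  _∘₂_ : Triangle → Triangle → Tree
  p ∘₂ q = node p leaf (node q leaf leaf)

  _−_ : Tree → Tree → Comb
  s − t = (1# , s) ∷ (- 1# , t) ∷ []

  data RelGen : Comb → Set where
    rel1 : ∀ p₀ p₁ p₂ q₀ q₁ q₂ r₀ r₁ →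
           p₁ ⋆ q₀ ≡ r₁ ⋆ r₀ → ¬ (p₁ ⋆ q₀ ≡ 𝟙) →
           RelGen (((p₀ , p₁ , p₂) ∘₁ (q₀ , q₁ , q₂)) − ((p₀ , r₁ , p₂) ∘₁ (r₀ , q₁ , q₂)))
    rel2 : ∀ p₀ p₁ p₂ q₀ q₁ q₂ r₀ r₂ →
           p₁ ⋆ q₀ ≡ 𝟙 → r₂ ⋆ r₀ ≡ 𝟙 →
           RelGen (((p₀ , p₁ , p₂) ∘₁ (q₀ , q₁ , q₂)) − ((p₀ , q₁ , r₂) ∘₂ (r₀ , q₂ , p₂)))
    rel3 : ∀ p₀ p₁ p₂ q₀ q₁ q₂ r₀ r₂ →
           p₂ ⋆ q₀ ≡ r₂ ⋆ r₀ → ¬ (p₂ ⋆ q₀ ≡ 𝟙) →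
           RelGen (((p₀ , p₁ , p₂) ∘₂ (q₀ , q₁ , q₂)) − ((p₀ , p₁ , r₂) ∘₂ (r₀ , q₁ , q₂)))

  -- the operad ideal ⟨R_{NC M}⟩, arity by arity: the smallest family of
  -- subspaces containing R_{NC M} and closed under partial compositions
  -- (on either side) with elements of the free operad (trees suffice by
  -- bilinearity).
  data InIdeal : ℕ → Comb → Set (c ⊔ ℓ) where
    gen   : ∀ {x} → RelGen x → InIdeal 3 x
    zero  : ∀ {n} → InIdeal n []
    add   : ∀ {n x y} → InIdeal n x → InIdeal n y → InIdeal n (x ++ y)
    scale : ∀ {n x} (k : 𝕂) → InIdeal n x → InIdeal n (scaleF k x)
    resp  : ∀ {n x y} → x ≈F y → InIdeal n x → InIdeal n y
    compL : ∀ {m x} (t : Tree) (i : ℕ) → i < arity t → InIdeal m x →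
            InIdeal ((arity t + m) ∸ 1) (map (λ at → (proj₁ at , graft t i (proj₂ at))) x)
    compR : ∀ {n x} (t : Tree) (i : ℕ) → i < n → InIdeal n x →
            InIdeal ((n + arity t) ∸ 1) (map (λ at → (proj₁ at , graft (proj₂ at) i t)) x)

{-# OPTIONS --safe #-}
-- Evaluating a tree glues the cliques of its two subtrees onto the two edges of its root triangle,
-- so every arc of the result lies in the left block, lies in the right block, is a side of the
-- triangle, or straddles the split vertex and is then unlabelled.  This description shows at once
-- that evaluations are noncrossing and that each relation (1)-(3) preserves evaluation, so the
-- evaluation map kills the ideal.  Conversely the relations rewrite every tree into a normal form
-- whose root splits at the last solid arc out of vertex 0; a normal form is determined by its
-- evaluation, so a homogeneous combination with zero evaluation is a combination of differences
-- t - norm t, and lies in the ideal.  Splitting a noncrossing clique at that same vertex, and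
-- recursing, realizes it as an evaluation.
module Submission where

open import Defs
open import Data.Nat using (ℕ; zero; suc; _+_; _∸_; _≤_; _<_; z≤n; s≤s; z<s; s<s; _≤ᵇ_; _<ᵇ_; _≡ᵇ_)
open import Data.Nat.Properties
open import Data.Product using (Σ; _×_; _,_; proj₁; proj₂)
open import Data.Sum using (_⊎_; inj₁; inj₂; [_,_]′)
import Data.Fin.Properties as FinP
open import Data.Bool using (Bool; true; false; if_then_else_; _∧_)
open import Data.Empty using (⊥-elim)
open import Relation.Binary.PropositionalEquality using (_≡_; refl; sym; trans; cong; cong₂; subst; subst₂; module ≡-Reasoning)
open import Relation.Nullary using (¬_; yes; no; contradiction)
open import Relation.Nullary.Decidable using (does; dec-true; dec-false; does-⇔; _×-dec_)
open import Function.Bundles using (_⇔_; mk⇔)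
open import Relation.Binary.Structures using (IsEquivalence)
open import Relation.Binary.Definitions using (tri<; tri≈; tri>)
open import Function.Base using (_∘_)
open import Induction.WellFounded using (Acc; acc)
open import Data.Nat.Induction using (<-wellFounded)
open import Data.List using (List; []; _∷_; _++_; map; deduplicate)
open import Data.List.Relation.Unary.All as All using (All; []; _∷_)
open import Data.List.Relation.Unary.Any as Any using (here; there; any?)
open import Data.List.Relation.Unary.All.Properties using (¬Any⇒All¬)
open import Data.List.Membership.Propositional using (_∈_)
open import Data.List.Membership.Propositional.Properties using (∈-deduplicate⁺; ∈-++⁺ˡ; ∈-++⁺ʳ)
open import Data.List.Relation.Unary.Unique.Propositional using (Unique)
open import Data.List.Relation.Unary.AllPairs using ([]; _∷_)
open import Data.List.Relation.Unary.Unique.DecPropositional.Properties using (deduplicate-!)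
import Algebra.Properties.AbelianGroup
import Algebra.Properties.CommutativeSemigroup
import Algebra.Properties.Ring
import Relation.Binary.Reasoning.Setoid
open import Relation.Binary.Construct.Closure.ReflexiveTransitive using (ε; _◅_; _◅◅_)
open import Relation.Binary.Construct.Closure.Symmetric using (fwd; bwd)
open import Relation.Binary.Construct.Closure.Equivalence using (EqClosure; gmap; gfold)

≤ᵇ-true : ∀ {m n} → m ≤ n → (m ≤ᵇ n) ≡ true
≤ᵇ-true {m} {n} = dec-true (m ≤? n)

≤ᵇ-false : ∀ {m n} → n < m → (m ≤ᵇ n) ≡ false
≤ᵇ-false {m} {n} n<m = dec-false (m ≤? n) (<⇒≱ n<m)

<ᵇ-true : ∀ {m n} → m < n → (m <ᵇ n) ≡ true
<ᵇ-true {m} {n} = dec-true (m <? n)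

<ᵇ-false : ∀ {m n} → n ≤ m → (m <ᵇ n) ≡ false
<ᵇ-false {m} {n} n≤m = dec-false (m <? n) (≤⇒≯ n≤m)

≡ᵇ-refl : ∀ n → (n ≡ᵇ n) ≡ true
≡ᵇ-refl n = dec-true (n ≟ n) refl

≡ᵇ∧≡ᵇ-false : ∀ {x j y k} → ¬ (x ≡ j × y ≡ k) → ((x ≡ᵇ j) ∧ (y ≡ᵇ k)) ≡ false
≡ᵇ∧≡ᵇ-false {x} {j} {y} {k} = dec-false ((x ≟ j) ×-dec (y ≟ k))

≤ᵇ∧≤ᵇ-false : ∀ {j x y k} → ¬ (j ≤ x × y ≤ k) → ((j ≤ᵇ x) ∧ (y ≤ᵇ k)) ≡ false
≤ᵇ∧≤ᵇ-false {j} {x} {y} {k} = dec-false ((j ≤? x) ×-dec (y ≤? k))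

m+n+1∸n≡1+m : ∀ m n → m + n + 1 ∸ n ≡ suc m
m+n+1∸n≡1+m m n = trans (cong (_∸ n) (+-comm (m + n) 1)) (m+n∸n≡m (suc m) n)

1+m+1∸m≡2 : ∀ m → suc m + 1 ∸ m ≡ 2
1+m+1∸m≡2 m = trans (cong (_∸ m) (sym (+-suc m 1))) (m+n∸m≡n m 2)

∸-<-cancelˡ : ∀ {i m n} → m ≤ i → i < m + n → i ∸ m < n
∸-<-cancelˡ {i} {m} {n} m≤i i<m+n = +-cancelˡ-< m (i ∸ m) n (subst (_< m + n) (sym (m+[n∸m]≡n m≤i)) i<m+n)

c+b+a≡a+b+c : ∀ a b c → c + b + a ≡ a + b + c
c+b+a≡a+b+c a b c = trans (+-comm (c + b) a) (trans (cong (a +_) (+-comm c b)) (sym (+-assoc a b c)))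

+-cancelˡ-≡′ : ∀ {m m′ n n′} → m ≡ m′ → m + n ≡ m′ + n′ → n ≡ n′
+-cancelˡ-≡′ {m} refl = +-cancelˡ-≡ m _ _

module Proof {c ℓ} (K : Field c ℓ) (M : FiniteUnitaryMagma) where
  open NC K M

  private
    variable
      j m n x y L R : ℕ
      p q P Q P′ Q′ : Clique
      s s′ t : Tree

  compC-before : x < y → y ≤ j → compC p j m q x y ≡ p x y
  compC-before x<y y≤j
    rewrite ≤ᵇ-false (<-≤-trans x<y y≤j) | ≤ᵇ-true (<⇒≤ (<-≤-trans x<y y≤j)) | ≤ᵇ-true y≤j = refl

  compC-base : compC p j m q j (j + m) ≡ p j (suc j) ⋆ q 0 m
  compC-base {j = j} {m = m}
    rewrite ≤ᵇ-true (≤-refl {j}) | ≤ᵇ-true (≤-refl {j + m}) | ≡ᵇ-refl j | ≡ᵇ-refl (j + m) = refl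

  compC-inside : j ≤ x → y ≤ j + m → ¬ (x ≡ j × y ≡ j + m) → compC p j m q x y ≡ q (x ∸ j) (y ∸ j)
  compC-inside j≤x y≤j+m ¬base rewrite ≤ᵇ-true j≤x | ≤ᵇ-true y≤j+m | ≡ᵇ∧≡ᵇ-false ¬base = refl

  compC-after : 1 ≤ m → j + m ≤ x → x < y → compC p j m q x y ≡ p (x + 1 ∸ m) (y + 1 ∸ m)
  compC-after {m = m} {j = j} 1≤m j+m≤x x<y
    rewrite ≤ᵇ-true (≤-trans (m≤m+n j m) j+m≤x) | ≤ᵇ-false (≤-<-trans j+m≤x x<y)
          | ≤ᵇ-false (<-≤-trans (m<m+n j 1≤m) j+m≤x) | ≤ᵇ-true j+m≤x
          | ≤ᵇ-false (<-trans (<-≤-trans (m<m+n j 1≤m) j+m≤x) x<y) | ≤ᵇ-true (≤-trans j+m≤x (<⇒≤ x<y)) = refl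

  compC-straddle : 1 ≤ m → x ≤ j → j + m ≤ y → ¬ (x ≡ j × y ≡ j + m) → compC p j m q x y ≡ p x (y + 1 ∸ m)
  compC-straddle {m = m} {j = j} 1≤m x≤j j+m≤y ¬base
    rewrite ≤ᵇ∧≤ᵇ-false (λ (j≤x , y≤j+m) → ¬base (≤-antisym x≤j j≤x , ≤-antisym y≤j+m j+m≤y))
          | ≤ᵇ-true x≤j | ≤ᵇ-false (<-≤-trans (m<m+n j 1≤m) j+m≤y) | ≤ᵇ-true j+m≤y = refl

  compC-gapˡ : x < j → j < y → y < j + m → compC p j m q x y ≡ 𝟙
  compC-gapˡ x<j j<y y<j+m rewrite ≤ᵇ-false x<j | ≤ᵇ-true (<⇒≤ x<j) | ≤ᵇ-false j<y | ≤ᵇ-false y<j+m = refl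

  compC-gapʳ : j < x → x < j + m → j + m < y → compC p j m q x y ≡ 𝟙
  compC-gapʳ j<x x<j+m j+m<y rewrite ≤ᵇ-true (<⇒≤ j<x) | ≤ᵇ-false j+m<y | ≤ᵇ-false j<x | ≤ᵇ-false x<j+m = refl

  ≐-refl : P ≐[ n ] P
  ≐-refl _ _ = refl

  ≐-sym : P ≐[ n ] Q → Q ≐[ n ] P
  ≐-sym eq y< x<y = sym (eq y< x<y)

  ≐-trans : P ≐[ n ] Q → Q ≐[ n ] P′ → P ≐[ n ] P′
  ≐-trans eq eq′ y< x<y = trans (eq y< x<y) (eq′ y< x<y)

  ≐-cast : m ≡ n → P ≐[ m ] Q → P ≐[ n ] Q
  ≐-cast refl eq = eq

  InnerArc : ℕ → ℕ → ℕ → Set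
  InnerArc n x y = x < y × y ≤ n × ¬ (x ≡ 0 × y ≡ n)

  infix 4 _≐ᵒ[_]_
  _≐ᵒ[_]_ : Clique → ℕ → Clique → Set
  P ≐ᵒ[ n ] Q = ∀ {x y} → InnerArc n x y → P x y ≡ Q x y

  ≐⇒≐ᵒ : P ≐[ n ] Q → P ≐ᵒ[ n ] Q
  ≐⇒≐ᵒ eq (x<y , y≤n , _) = eq (s≤s y≤n) x<y

  ≐ᵒ⇒≐ : P ≐ᵒ[ n ] Q → P 0 n ≡ Q 0 n → P ≐[ n ] Q
  ≐ᵒ⇒≐ {n = n} eq eq₀ {y} y<1+n {x} x<y with (x ≟ 0) ×-dec (y ≟ n)
  ... | yes (refl , refl) = eq₀
  ... | no ¬base = eq (x<y , ≤-pred y<1+n , ¬base)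

  -- Gluing two cliques onto the edges of a triangle

  -- ev (node T l r) is, by definition, glue T (arity l) (arity r) (ev l) (ev r)
  glue : Triangle → ℕ → ℕ → Clique → Clique → Clique
  glue T L R P Q = compC (compC (triC T) 0 L P) L R Q

  -- Where an arc of glue T L R P Q lies.  The constructors carry equations instead of refining
  -- x and y, so that a region can be given for arcs written as arbitrary expressions.
  data Region (L R x y : ℕ) : Set where
    inLeft    : InnerArc L x y → Region L R x y
    leftBase  : x ≡ 0 → y ≡ L → Region L R x y
    inRight   : ∀ x′ y′ → x ≡ L + x′ → y ≡ L + y′ → InnerArc R x′ y′ → Region L R x y
    rightBase : x ≡ L → y ≡ L + R → Region L R x y
    top       : x ≡ 0 → y ≡ L + R → Region L R x y
    across    : x < L → L < y → y ≤ L + R → ¬ (x ≡ 0 × y ≡ L + R) → Region L R x y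

  innerArc-unshift : ∀ {x′ y′} → x ≡ L + x′ → y ≡ L + y′ → x < y → y ≤ L + R →
                     ¬ (x ≡ L × y ≡ L + R) → InnerArc R x′ y′
  innerArc-unshift {L = L} refl refl x<y y≤ ¬base =
    +-cancelˡ-< L _ _ x<y , +-cancelˡ-≤ L _ _ y≤ ,
    λ (x′≡0 , y′≡R) → ¬base (trans (cong (L +_) x′≡0) (+-identityʳ L) , cong (L +_) y′≡R)

  region : x < y → y ≤ L + R → Region L R x y
  region {x} {y} {L} {R} x<y y≤ with y ≤? L | L ≤? x
  ... | yes y≤L | _ with (x ≟ 0) ×-dec (y ≟ L)
  ...   | yes (x≡0 , y≡L) = leftBase x≡0 y≡L
  ...   | no ¬base = inLeft (x<y , y≤L , ¬base)
  region {x} {y} {L} {R} x<y y≤ | no y≰L | yes L≤x with (x ≟ L) ×-dec (y ≟ L + R)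
  ... | yes (x≡L , y≡L+R) = rightBase x≡L y≡L+R
  ... | no ¬base = inRight (x ∸ L) (y ∸ L) x≡ y≡ (innerArc-unshift x≡ y≡ x<y y≤ ¬base)
    where
    x≡ : x ≡ L + (x ∸ L)
    x≡ = sym (m+[n∸m]≡n L≤x)
    y≡ : y ≡ L + (y ∸ L)
    y≡ = sym (m+[n∸m]≡n (≤-trans L≤x (<⇒≤ x<y)))
  region {x} {y} {L} {R} x<y y≤ | no y≰L | no L≰x with (x ≟ 0) ×-dec (y ≟ L + R)
  ... | yes (x≡0 , y≡L+R) = top x≡0 y≡L+R
  ... | no ¬top = across (≰⇒> L≰x) (≰⇒> y≰L) y≤ ¬top

  label : ∀ {L R x y} → Triangle → Clique → Clique → Region L R x y → Elt
  label {x = x} {y} _ P _ (inLeft _) = P x y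
  label {L} (_ , b , _) P _ (leftBase _ _) = b ⋆ P 0 L
  label _ _ Q (inRight x′ y′ _ _ _) = Q x′ y′
  label {R = R} (_ , _ , c) _ Q (rightBase _ _) = c ⋆ Q 0 R
  label (a , _ , _) _ _ (top _ _) = a
  label _ _ _ (across _ _ _ _) = 𝟙

  glue-label : ∀ {a b c} → 1 ≤ L → 1 ≤ R → (v : Region L R x y) →
               glue (a , b , c) L R P Q x y ≡ label (a , b , c) P Q v
  glue-label {L} {R} {P = P} {Q} {a} {b} {c} 1≤L 1≤R v = go v
    where
    T inner : Clique
    T = triC (a , b , c)
    inner = compC T 0 L P
    go : ∀ {x y} (v : Region L R x y) → compC inner L R Q x y ≡ label (a , b , c) P Q v
    go (inLeft (x<y , y≤L , ¬base)) =
      trans (compC-before {p = inner} {q = Q} x<y y≤L) (compC-inside {p = T} {q = P} z≤n y≤L ¬base)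
    go (leftBase refl refl) = trans (compC-before {p = inner} {q = Q} 1≤L ≤-refl) (compC-base {p = T} {j = 0} {m = L} {q = P})
    go (inRight x′ y′ refl refl (x′<y′ , y′≤R , ¬base)) =
      trans (compC-inside {p = inner} {q = Q} (m≤m+n L x′) (+-monoʳ-≤ L y′≤R) ¬base′)
            (cong₂ Q (m+n∸m≡n L x′) (m+n∸m≡n L y′))
      where
      ¬base′ : ¬ (L + x′ ≡ L × L + y′ ≡ L + R)
      ¬base′ (e₁ , e₂) = ¬base (+-cancelˡ-≡ L x′ 0 (trans e₁ (sym (+-identityʳ L))) , +-cancelˡ-≡ L y′ R e₂)
    go (rightBase refl refl) =
      trans (compC-base {p = inner} {j = L} {m = R} {q = Q})
            (cong (_⋆ Q 0 R) (trans (compC-after {p = T} {q = P} 1≤L ≤-refl (n<1+n L))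
                                    (cong₂ T (m+n∸m≡n L 1) (1+m+1∸m≡2 L))))
    go (top refl refl) =
      trans (compC-straddle {p = inner} {q = Q} 1≤R z≤n ≤-refl (λ (0≡L , _) → <⇒≢ 1≤L 0≡L))
            (trans (cong (inner 0) (m+n+1∸n≡1+m L R))
                   (trans (compC-straddle {p = T} {q = P} 1≤L z≤n (n≤1+n L) (λ (_ , e) → <⇒≢ (n<1+n L) (sym e)))
                          (cong (T 0) (1+m+1∸m≡2 L))))
    go {x} (across x<L L<y y≤ ¬top) with m≤n⇒m<n∨m≡n y≤
    ... | inj₁ y<L+R = compC-gapˡ {p = inner} {q = Q} x<L L<y y<L+R
    ... | inj₂ refl =
      trans (compC-straddle {p = inner} {q = Q} 1≤R (<⇒≤ x<L) ≤-refl (λ (x≡L , _) → <⇒≢ x<L x≡L))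
            (trans (cong (inner x) (m+n+1∸n≡1+m L R))
                   (compC-gapʳ {p = T} {q = P} (n≢0⇒n>0 (λ x≡0 → ¬top (x≡0 , refl))) x<L (n<1+n L)))

  region-arc : 1 ≤ L → 1 ≤ R → Region L R x y → x < y × y ≤ L + R
  region-arc {L} {R} 1≤L 1≤R (inLeft (x<y , y≤L , _)) = x<y , ≤-trans y≤L (m≤m+n L R)
  region-arc {L} {R} 1≤L 1≤R (leftBase refl refl) = 1≤L , m≤m+n L R
  region-arc {L} {R} 1≤L 1≤R (inRight x′ y′ refl refl (x′<y′ , y′≤R , _)) = +-monoʳ-< L x′<y′ , +-monoʳ-≤ L y′≤R
  region-arc {L} {R} 1≤L 1≤R (rightBase refl refl) = m<m+n L 1≤R , ≤-refl
  region-arc {L} {R} 1≤L 1≤R (top refl refl) = ≤-trans 1≤L (m≤m+n L R) , ≤-refl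
  region-arc 1≤L 1≤R (across x<L L<y y≤ _) = <-trans x<L L<y , y≤

  module _ {a b c a′ b′ c′ : Elt} {P Q P′ Q′ : Clique} (1≤L : 1 ≤ L) (1≤R : 1 ≤ R) where

    label-≡⇒glue-≐ : (∀ {x y} (v : Region L R x y) → label (a , b , c) P Q v ≡ label (a′ , b′ , c′) P′ Q′ v) →
             glue (a , b , c) L R P Q ≐[ L + R ] glue (a′ , b′ , c′) L R P′ Q′
    label-≡⇒glue-≐ same {y} y< {x} x<y = trans (glue-label 1≤L 1≤R v) (trans (same v) (sym (glue-label 1≤L 1≤R v)))
      where
      v : Region L R x y
      v = region x<y (≤-pred y<)

    glue-≐⇒label-≡ : glue (a , b , c) L R P Q ≐[ L + R ] glue (a′ , b′ , c′) L R P′ Q′ →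
                   (v : Region L R x y) → label (a , b , c) P Q v ≡ label (a′ , b′ , c′) P′ Q′ v
    glue-≐⇒label-≡ eq v with region-arc 1≤L 1≤R v
    ... | x<y , y≤ = trans (sym (glue-label 1≤L 1≤R v)) (trans (eq (s≤s y≤) x<y) (glue-label 1≤L 1≤R v))

    glue-≐-inv : glue (a , b , c) L R P Q ≐[ L + R ] glue (a′ , b′ , c′) L R P′ Q′ →
                 a ≡ a′ × b ⋆ P 0 L ≡ b′ ⋆ P′ 0 L × c ⋆ Q 0 R ≡ c′ ⋆ Q′ 0 R × P ≐ᵒ[ L ] P′ × Q ≐ᵒ[ R ] Q′
    glue-≐-inv eq =
      at (top refl refl) , at (leftBase refl refl) , at (rightBase refl refl) ,
      (λ arc → at (inLeft arc)) , (λ {x′} {y′} arc → at (inRight x′ y′ refl refl arc))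
      where
      at : (v : Region L R x y) → label (a , b , c) P Q v ≡ label (a′ , b′ , c′) P′ Q′ v
      at = glue-≐⇒label-≡ eq

  glue-cong : ∀ {a b c b′ c′ L R} {P P′ Q Q′ : Clique} → 1 ≤ L → 1 ≤ R →
              b ⋆ P 0 L ≡ b′ ⋆ P′ 0 L → c ⋆ Q 0 R ≡ c′ ⋆ Q′ 0 R → P ≐ᵒ[ L ] P′ → Q ≐ᵒ[ R ] Q′ →
              glue (a , b , c) L R P Q ≐[ L + R ] glue (a , b′ , c′) L R P′ Q′
  glue-cong {a} {b} {c} {b′} {c′} {L} {R} {P} {P′} {Q} {Q′} 1≤L 1≤R eb ec eP eQ = label-≡⇒glue-≐ 1≤L 1≤R same
    where
    same : (v : Region L R x y) → label (a , b , c) P Q v ≡ label (a , b′ , c′) P′ Q′ v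
    same (inLeft arc) = eP arc
    same (leftBase _ _) = eb
    same (inRight _ _ _ _ arc) = eQ arc
    same (rightBase _ _) = ec
    same (top _ _) = refl
    same (across _ _ _ _) = refl

  glue-base-irrelevant : ∀ {a a′ b c} → 1 ≤ L → 1 ≤ R → glue (a , b , c) L R P Q ≐ᵒ[ L + R ] glue (a′ , b , c) L R P Q
  glue-base-irrelevant {L} {R} {P} {Q} {a} {a′} {b} {c} 1≤L 1≤R {x} {y} (x<y , y≤ , ¬base) =
    trans (glue-label 1≤L 1≤R v) (trans (same v) (sym (glue-label 1≤L 1≤R v)))
    where
    v : Region L R x y
    v = region x<y y≤
    same : (v : Region L R x y) → label (a , b , c) P Q v ≡ label (a′ , b , c) P Q v
    same (top e₁ e₂) = contradiction (e₁ , e₂) ¬base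
    same (inLeft _) = refl
    same (leftBase _ _) = refl
    same (inRight _ _ _ _ _) = refl
    same (rightBase _ _) = refl
    same (across _ _ _ _) = refl

  glue-congˡ : ∀ {a b c L L′ R} {P P′ Q : Clique} → L ≡ L′ → 1 ≤ L → 1 ≤ R → P ≐[ L ] P′ →
               glue (a , b , c) L R P Q ≐[ L + R ] glue (a , b , c) L′ R P′ Q
  glue-congˡ {b = b} {L = L} {P = P} {P′ = P′} {Q = Q} refl 1≤L 1≤R eq =
    glue-cong {P = P} {P′ = P′} {Q = Q} {Q′ = Q} 1≤L 1≤R
              (cong (b ⋆_) (eq (n<1+n L) 1≤L)) refl (≐⇒≐ᵒ eq) (λ _ → refl)

  glue-congʳ : ∀ {a b c L R R′} {P Q Q′ : Clique} → R ≡ R′ → 1 ≤ L → 1 ≤ R → Q ≐[ R ] Q′ →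
               glue (a , b , c) L R P Q ≐[ L + R ] glue (a , b , c) L R′ P Q′
  glue-congʳ {c = c} {R = R} {P = P} {Q = Q} {Q′ = Q′} refl 1≤L 1≤R eq =
    glue-cong {P = P} {P′ = P} {Q = Q} {Q′ = Q′} 1≤L 1≤R
              refl (cong (c ⋆_) (eq (n<1+n R) 1≤R)) (λ _ → refl) (≐⇒≐ᵒ eq)

  module _ {i j k : ℕ} {A B C : Clique} {p₀ p₁ p₂ q₀ q₁ q₂ r₀ r₂ : Elt}
           (1≤i : 1 ≤ i) (1≤j : 1 ≤ j) (1≤k : 1 ≤ k) (p₁q₀≡𝟙 : p₁ ⋆ q₀ ≡ 𝟙) (r₂r₀≡𝟙 : r₂ ⋆ r₀ ≡ 𝟙) where
    private
      I J rhs : Clique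
      I = glue (q₀ , q₁ , q₂) i j A B
      J = glue (r₀ , q₂ , p₂) j k B C
      rhs = glue (p₀ , q₁ , r₂) i (j + k) A J

      I-label : (w : Region i j x y) → I x y ≡ label (q₀ , q₁ , q₂) A B w
      I-label = glue-label 1≤i 1≤j

      J-label : (w : Region j k x y) → J x y ≡ label (r₀ , q₂ , p₂) B C w
      J-label = glue-label 1≤j 1≤k

      rhs-label : (w : Region i (j + k) x y) → rhs x y ≡ label (p₀ , q₁ , r₂) A J w
      rhs-label = glue-label 1≤i (≤-trans 1≤j (m≤m+n j k))

      j<j+k : j < j + k
      j<j+k = m<m+n j 1≤k

      assoc-left : (w : Region i j x y) → y ≤ i + j → ¬ (x ≡ 0 × y ≡ i + j) → label (q₀ , q₁ , q₂) A B w ≡ rhs x y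
      assoc-left (inLeft arc) _ _ = sym (rhs-label (inLeft arc))
      assoc-left (leftBase e₁ e₂) _ _ = sym (rhs-label (leftBase e₁ e₂))
      assoc-left (inRight x′ y′ ex ey arc@(x′<y′ , y′≤j , _)) _ _ =
        sym (trans (rhs-label (inRight x′ y′ ex ey (x′<y′ , ≤-trans y′≤j (<⇒≤ j<j+k) ,
                                                    λ (_ , e) → <⇒≢ (≤-<-trans y′≤j j<j+k) e)))
                   (J-label (inLeft arc)))
      assoc-left (rightBase e₁ e₂) _ _ =
        sym (trans (rhs-label (inRight 0 j (trans e₁ (sym (+-identityʳ i))) e₂
                                       (1≤j , <⇒≤ j<j+k , λ (_ , e) → <⇒≢ j<j+k e)))
                   (J-label (leftBase refl refl)))
      assoc-left (top e₁ e₂) _ ¬base = contradiction (e₁ , e₂) ¬base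
      assoc-left {y = y} (across x<i i<y _ _) y≤i+j _ =
        sym (rhs-label (across x<i i<y (<⇒≤ y<i+[j+k]) (λ (_ , e) → <⇒≢ y<i+[j+k] e)))
        where
        y<i+[j+k] : y < i + (j + k)
        y<i+[j+k] = ≤-<-trans y≤i+j (+-monoʳ-< i j<j+k)

      assoc-across : x < i + j → i + j < y → y ≤ i + j + k → ¬ (x ≡ 0 × y ≡ i + j + k) → 𝟙 ≡ rhs x y
      assoc-across {x} {y} x<i+j i+j<y y≤ ¬top with x <? i
      ... | yes x<i =
        sym (rhs-label (across x<i (≤-<-trans (m≤m+n i j) i+j<y) (subst (y ≤_) (+-assoc i j k) y≤)
                               (λ (x≡0 , e) → ¬top (x≡0 , trans e (sym (+-assoc i j k))))))
      ... | no x≮i with (x ≟ i) ×-dec (y ≟ i + j + k)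
      ...   | yes (refl , refl) =
        sym (trans (rhs-label (rightBase refl (+-assoc i j k))) (trans (cong (r₂ ⋆_) (J-label (top refl refl))) r₂r₀≡𝟙))
      ...   | no ¬rightBase =
        sym (trans (rhs-label (inRight (x ∸ i) (y ∸ i) x≡ y≡ arc)) (J-label (across x′<j j<y′ y′≤ ¬top′)))
        where
        i≤x : i ≤ x
        i≤x = ≮⇒≥ x≮i
        x<y : x < y
        x<y = <-trans x<i+j i+j<y
        x≡ : x ≡ i + (x ∸ i)
        x≡ = sym (m+[n∸m]≡n i≤x)
        y≡ : y ≡ i + (y ∸ i)
        y≡ = sym (m+[n∸m]≡n (≤-trans i≤x (<⇒≤ x<y)))
        arc : InnerArc (j + k) (x ∸ i) (y ∸ i)
        arc = innerArc-unshift x≡ y≡ x<y (subst (y ≤_) (+-assoc i j k) y≤)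
                (λ (x≡i , e) → ¬rightBase (x≡i , trans e (sym (+-assoc i j k))))
        x′<j : x ∸ i < j
        x′<j = +-cancelˡ-< i (x ∸ i) j (subst (_< i + j) x≡ x<i+j)
        j<y′ : j < y ∸ i
        j<y′ = +-cancelˡ-< i j (y ∸ i) (subst (i + j <_) y≡ i+j<y)
        y′≤ : y ∸ i ≤ j + k
        y′≤ = proj₁ (proj₂ arc)
        ¬top′ : ¬ (x ∸ i ≡ 0 × y ∸ i ≡ j + k)
        ¬top′ = proj₂ (proj₂ arc)

    glue-assoc : glue (p₀ , p₁ , p₂) (i + j) k I C ≐[ i + j + k ] rhs
    glue-assoc {y} y< {x} x<y = trans (glue-label (≤-trans 1≤i (m≤m+n i j)) 1≤k v) (from-region v)
      where
      v : Region (i + j) k x y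
      v = region x<y (≤-pred y<)
      from-region : (v : Region (i + j) k x y) → label (p₀ , p₁ , p₂) I C v ≡ rhs x y
      from-region (inLeft (x<y , y≤ , ¬base)) = trans (I-label w) (assoc-left w y≤ ¬base)
        where
        w : Region i j x y
        w = region x<y y≤
      from-region (leftBase refl refl) =
        trans (cong (p₁ ⋆_) (I-label (top refl refl)))
              (trans p₁q₀≡𝟙 (sym (rhs-label (across 1≤i (m<m+n i 1≤j) (+-monoʳ-≤ i (<⇒≤ j<j+k))
                                                     (λ (_ , e) → <⇒≢ (+-monoʳ-< i j<j+k) e)))))
      from-region (inRight x′ y′ refl refl arc@(x′<y′ , y′≤k , _)) =
        sym (trans (rhs-label (inRight (j + x′) (j + y′) (+-assoc i j x′) (+-assoc i j y′) arc′))
                   (J-label (inRight x′ y′ refl refl arc)))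
        where
        arc′ : InnerArc (j + k) (j + x′) (j + y′)
        arc′ = +-monoʳ-< j x′<y′ , +-monoʳ-≤ j y′≤k , λ (e , _) → <⇒≢ (≤-trans 1≤j (m≤m+n j x′)) (sym e)
      from-region (rightBase refl refl) =
        sym (trans (rhs-label (inRight j (j + k) refl (+-assoc i j k) (j<j+k , ≤-refl , λ (e , _) → <⇒≢ 1≤j (sym e))))
                   (J-label (rightBase refl refl)))
      from-region (top refl refl) = sym (rhs-label (top refl (+-assoc i j k)))
      from-region (across x<i+j i+j<y y≤ ¬top) = assoc-across x<i+j i+j<y y≤ ¬top

  arity-pos : ∀ t → 1 ≤ arity t
  arity-pos leaf = s≤s z≤n
  arity-pos (node _ l r) = ≤-trans (arity-pos l) (m≤m+n (arity l) (arity r))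

  2≤arity-node : ∀ l r → 2 ≤ arity l + arity r
  2≤arity-node l r = +-mono-≤ (arity-pos l) (arity-pos r)

  ev-label : ∀ {a b c} l r (v : Region (arity l) (arity r) x y) →
             ev (node (a , b , c) l r) x y ≡ label (a , b , c) (ev l) (ev r) v
  ev-label l r = glue-label (arity-pos l) (arity-pos r)

  base : Tree → Elt
  base leaf = 𝟙
  base (node (a , _ , _) _ _) = a

  ev-base : ∀ t → ev t 0 (arity t) ≡ base t
  ev-base leaf = refl
  ev-base (node (a , b , c) l r) = ev-label l r (top refl refl)

  ev-base-at : ∀ t → arity t ≡ n → ev t 0 n ≡ base t
  ev-base-at t refl = ev-base t

  -- Evaluations are noncrossing

  Cross-sym : ∀ {x y x′ y′} → Cross x y x′ y′ → Cross x′ y′ x y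
  Cross-sym (inj₁ c) = inj₂ c
  Cross-sym (inj₂ c) = inj₁ c

  Cross-shift : ∀ o {x y x′ y′} → Cross x y x′ y′ → Cross (o + x) (o + y) (o + x′) (o + y′)
  Cross-shift o (inj₁ (a , b , c)) = inj₁ (+-monoʳ-< o a , +-monoʳ-< o b , +-monoʳ-< o c)
  Cross-shift o (inj₂ (a , b , c)) = inj₂ (+-monoʳ-< o a , +-monoʳ-< o b , +-monoʳ-< o c)

  Cross-unshift : ∀ o {x y x′ y′} → Cross (o + x) (o + y) (o + x′) (o + y′) → Cross x y x′ y′
  Cross-unshift o (inj₁ (a , b , c)) = inj₁ (+-cancelˡ-< o _ _ a , +-cancelˡ-< o _ _ b , +-cancelˡ-< o _ _ c)
  Cross-unshift o (inj₂ (a , b , c)) = inj₂ (+-cancelˡ-< o _ _ a , +-cancelˡ-< o _ _ b , +-cancelˡ-< o _ _ c)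

  disjoint-¬Cross : ∀ {x y x′ y′} → y ≤ x′ → ¬ Cross x y x′ y′
  disjoint-¬Cross y≤x′ (inj₁ (_ , x′<y , _)) = <⇒≱ x′<y y≤x′
  disjoint-¬Cross y≤x′ (inj₂ (x′<x , x<y′ , y′<y)) = <⇒≱ (<-trans x′<x (<-trans x<y′ y′<y)) y≤x′

  nested-¬Cross : ∀ {x y x′ y′} → x ≤ x′ → y′ ≤ y → ¬ Cross x y x′ y′
  nested-¬Cross _ y′≤y (inj₁ (_ , _ , y<y′)) = <⇒≱ y<y′ y′≤y
  nested-¬Cross x≤x′ _ (inj₂ (x′<x , _ , _)) = <⇒≱ x′<x x≤x′

  data BlockArc (k : ℕ) (S : Clique) (o x y : ℕ) : Set where
    solidDiagonal : ∀ x′ y′ → x ≡ o + x′ → y ≡ o + y′ → Diagonal k x′ y′ → Solid S x′ y′ → BlockArc k S o x y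
    wholeBlock    : x ≡ o → y ≡ o + k → BlockArc k S o x y

  blockArc-bounds : ∀ {k S o x y} → BlockArc k S o x y → o ≤ x × y ≤ o + k
  blockArc-bounds {o = o} (solidDiagonal x′ _ refl refl (_ , y′≤k , _) _) = m≤m+n o x′ , +-monoʳ-≤ o y′≤k
  blockArc-bounds (wholeBlock refl refl) = ≤-refl , ≤-refl

  blockArc-¬Cross : ∀ {k S o x y x′ y′} → NonCrossing k S → BlockArc k S o x y → BlockArc k S o x′ y′ →
                    ¬ Cross x y x′ y′
  blockArc-¬Cross {o = o} nc (solidDiagonal x₁ y₁ refl refl d s) (solidDiagonal x₂ y₂ refl refl d′ s′) cr =
    nc x₁ y₁ x₂ y₂ d d′ s s′ (Cross-unshift o cr)
  blockArc-¬Cross nc (wholeBlock refl refl) β = nested-¬Cross (proj₁ (blockArc-bounds β)) (proj₂ (blockArc-bounds β))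
  blockArc-¬Cross nc β (wholeBlock refl refl) =
    nested-¬Cross (proj₁ (blockArc-bounds β)) (proj₂ (blockArc-bounds β)) ∘ Cross-sym

  region-solidDiagonal : ∀ {a b c} → Diagonal (L + R) x y → (v : Region L R x y) → ¬ label (a , b , c) P Q v ≡ 𝟙 →
                         BlockArc L P 0 x y ⊎ BlockArc R Q L x y
  region-solidDiagonal {x = x} {y} (x<y , _ , ¬edge , _) (inLeft (_ , y≤L , ¬base)) solid =
    inj₁ (solidDiagonal x y refl refl (x<y , y≤L , ¬edge , ¬base) solid)
  region-solidDiagonal _ (leftBase e₁ e₂) _ = inj₁ (wholeBlock e₁ e₂)
  region-solidDiagonal {L} (_ , _ , ¬edge , _) (inRight x′ y′ ex ey (x′<y′ , y′≤R , ¬base)) solid =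
    inj₂ (solidDiagonal x′ y′ ex ey (x′<y′ , y′≤R , ¬edge′ , ¬base) solid)
    where
    ¬edge′ : ¬ suc x′ ≡ y′
    ¬edge′ e = ¬edge (trans (cong suc ex) (trans (sym (+-suc L x′)) (trans (cong (L +_) e) (sym ey))))
  region-solidDiagonal _ (rightBase e₁ e₂) _ = inj₂ (wholeBlock e₁ e₂)
  region-solidDiagonal (_ , _ , _ , ¬top) (top e₁ e₂) _ = contradiction (e₁ , e₂) ¬top
  region-solidDiagonal _ (across _ _ _ _) solid = contradiction refl solid

  glue-noncrossing : ∀ {a b c} → 1 ≤ L → 1 ≤ R → NonCrossing L P → NonCrossing R Q →
                     NonCrossing (L + R) (glue (a , b , c) L R P Q)
  glue-noncrossing {L} {R} {P} {Q} {a} {b} {c} 1≤L 1≤R ncP ncQ x y x′ y′ d d′ s s′ cr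
    with block d s | block d′ s′
    where
    block : ∀ {x y} → Diagonal (L + R) x y → Solid (glue (a , b , c) L R P Q) x y → BlockArc L P 0 x y ⊎ BlockArc R Q L x y
    block {x} {y} d@(x<y , y≤ , _) s = region-solidDiagonal d v (λ e → s (trans (glue-label 1≤L 1≤R v) e))
      where
      v : Region L R x y
      v = region x<y y≤
  ... | inj₁ β | inj₁ β′ = blockArc-¬Cross ncP β β′ cr
  ... | inj₂ β | inj₂ β′ = blockArc-¬Cross ncQ β β′ cr
  ... | inj₁ β | inj₂ β′ = disjoint-¬Cross (≤-trans (proj₂ (blockArc-bounds β)) (proj₁ (blockArc-bounds β′))) cr
  ... | inj₂ β | inj₁ β′ =
    disjoint-¬Cross (≤-trans (proj₂ (blockArc-bounds β′)) (proj₁ (blockArc-bounds β))) (Cross-sym cr)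

  ev-noncrossing : ∀ t → NonCrossing (arity t) (ev t)
  ev-noncrossing leaf _ _ _ _ (x<y , y≤1 , ¬edge , _) _ _ _ _ = ¬edge (≤-antisym x<y (≤-trans y≤1 (s≤s z≤n)))
  ev-noncrossing (node (a , b , c) l r) =
    glue-noncrossing (arity-pos l) (arity-pos r) (ev-noncrossing l) (ev-noncrossing r)

  ev-isNCClique : ∀ t → IsNCClique (arity t) (ev t)
  ev-isNCClique t = arity-one t , ev-noncrossing t
    where
    arity-one : ∀ t → arity t ≡ 1 → ev t 0 1 ≡ 𝟙
    arity-one leaf _ = refl
    arity-one (node _ l r) e = contradiction (sym e) (<⇒≢ (2≤arity-node l r))

  -- Every noncrossing clique is an evaluation

  -- the largest k ≤ j with p 0 k solid, or 1 if there is none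
  lastSolid : Clique → ℕ → ℕ
  lastSolid p zero = 1
  lastSolid p (suc zero) = 1
  lastSolid p (suc (suc j)) = if does (p 0 (suc (suc j)) FinP.≟ 𝟙) then lastSolid p (suc j) else suc (suc j)

  lastSolid-pos : ∀ p j → 1 ≤ lastSolid p j
  lastSolid-pos p zero = s≤s z≤n
  lastSolid-pos p (suc zero) = s≤s z≤n
  lastSolid-pos p (suc (suc j)) with lastSolid-pos p (suc j) | p 0 (suc (suc j)) FinP.≟ 𝟙
  ... | ih | yes _ = ih
  ... | _ | no _ = s≤s z≤n

  lastSolid-≤ : ∀ p j → 1 ≤ j → lastSolid p j ≤ j
  lastSolid-≤ p (suc zero) _ = ≤-refl
  lastSolid-≤ p (suc (suc j)) _ with lastSolid-≤ p (suc j) (s≤s z≤n) | p 0 (suc (suc j)) FinP.≟ 𝟙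
  ... | ih | yes _ = ≤-trans ih (n≤1+n (suc j))
  ... | _ | no _ = ≤-refl

  lastSolid-solid : ∀ p j → 2 ≤ lastSolid p j → Solid p 0 (lastSolid p j)
  lastSolid-solid p zero (s≤s ())
  lastSolid-solid p (suc zero) (s≤s ())
  lastSolid-solid p (suc (suc j)) with lastSolid-solid p (suc j) | p 0 (suc (suc j)) FinP.≟ 𝟙
  ... | ih | yes _ = ih
  ... | _ | no solid = λ _ → solid

  lastSolid-max : ∀ p j {y} → lastSolid p j < y → y ≤ j → p 0 y ≡ 𝟙
  lastSolid-max p zero k<y y≤j = contradiction y≤j (<⇒≱ (≤-trans (s≤s z≤n) k<y))
  lastSolid-max p (suc zero) k<y y≤j = contradiction y≤j (<⇒≱ k<y)
  lastSolid-max p (suc (suc j)) {y} with lastSolid-max p (suc j) {y} | p 0 (suc (suc j)) FinP.≟ 𝟙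
  ... | _ | no _ = λ k<y y≤j → contradiction y≤j (<⇒≱ k<y)
  ... | ih | yes unit = λ k<y y≤j → [ (λ y<j → ih k<y (≤-pred y<j)) , (λ { refl → unit }) ]′ (m≤n⇒m<n∨m≡n y≤j)

  subclique : Clique → ℕ → ℕ → Clique
  subclique p o k x y = if (x ≡ᵇ 0) ∧ (y ≡ᵇ k) then 𝟙 else p (o + x) (o + y)

  subclique-base : ∀ p o k → subclique p o k 0 k ≡ 𝟙
  subclique-base p o k rewrite ≡ᵇ-refl k = refl

  subclique-inner : ∀ p o {k x y} → ¬ (x ≡ 0 × y ≡ k) → subclique p o k x y ≡ p (o + x) (o + y)
  subclique-inner p o ¬base rewrite ≡ᵇ∧≡ᵇ-false ¬base = refl

  subclique-isNC : ∀ p o {k n} → o + k ≤ n → ¬ (o ≡ 0 × k ≡ n) → NonCrossing n p → IsNCClique k (subclique p o k)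
  subclique-isNC p o {k} {n} o+k≤n ¬whole nc = (λ { refl → subclique-base p o 1 }) , nc′
    where
    shift : ∀ {x y} → Diagonal k x y → Diagonal n (o + x) (o + y)
    shift {x} {y} (x<y , y≤k , ¬edge , _) =
      +-monoʳ-< o x<y , ≤-trans (+-monoʳ-≤ o y≤k) o+k≤n ,
      (λ e → ¬edge (+-cancelˡ-≡ o (suc x) y (trans (+-suc o x) e))) ,
      λ (o+x≡0 , o+y≡n) → ¬whole (m+n≡0⇒m≡0 o o+x≡0 , whole (m+n≡0⇒m≡0 o o+x≡0) o+y≡n y≤k)
      where
      whole : o ≡ 0 → o + y ≡ n → y ≤ k → k ≡ n
      whole refl refl y≤k = ≤-antisym o+k≤n y≤k
    solid : ∀ {x y} → Diagonal k x y → Solid (subclique p o k) x y → Solid p (o + x) (o + y)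
    solid (_ , _ , _ , ¬base) s = s ∘ trans (subclique-inner p o ¬base)
    nc′ : NonCrossing k (subclique p o k)
    nc′ x y x′ y′ d d′ s s′ cr =
      nc (o + x) (o + y) (o + x′) (o + y′) (shift d) (shift d′) (solid d s) (solid d′ s′) (Cross-shift o cr)

  lastSolid-clear : ∀ {j} p → NonCrossing (suc j) p → ∀ {x y} → x < lastSolid p j → lastSolid p j < y → y ≤ suc j →
                    ¬ (x ≡ 0 × y ≡ suc j) → p x y ≡ 𝟙
  lastSolid-clear {j} p nc {x} {y} x<k k<y y≤N ¬top with x ≟ 0
  ... | yes refl = lastSolid-max p j k<y (≤-pred (≤∧≢⇒< y≤N (λ y≡N → ¬top (refl , y≡N))))
  ... | no x≢0 with p x y FinP.≟ 𝟙
  ...   | yes unit = unit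
  ...   | no solid = ⊥-elim (nc 0 k x y d₀ dxy (lastSolid-solid p j 2≤k) solid (inj₁ (n≢0⇒n>0 x≢0 , x<k , k<y)))
    where
    k : ℕ
    k = lastSolid p j
    2≤k : 2 ≤ k
    2≤k = ≤-trans (s≤s (n≢0⇒n>0 x≢0)) x<k
    k<N : k < suc j
    k<N = <-≤-trans k<y y≤N
    d₀ : Diagonal (suc j) 0 k
    d₀ = ≤-trans (s≤s z≤n) 2≤k , <⇒≤ k<N , <⇒≢ 2≤k , λ (_ , k≡N) → <⇒≢ k<N k≡N
    dxy : Diagonal (suc j) x y
    dxy = <-trans x<k k<y , y≤N , (λ 1+x≡y → <⇒≱ k<y (subst (_≤ k) 1+x≡y x<k)) , λ (x≡0 , _) → x≢0 x≡0

  glue-split : ∀ p {k m n} {P Q : Clique} → k + m ≡ n → 1 ≤ k → 1 ≤ m →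
               (∀ {x y} → x < k → k < y → y ≤ n → ¬ (x ≡ 0 × y ≡ n) → p x y ≡ 𝟙) →
               P ≐[ k ] subclique p 0 k → Q ≐[ m ] subclique p k m →
               glue (p 0 n , p 0 k , p k n) k m P Q ≐[ n ] p
  glue-split p {k} {m} {P = P} {Q} refl 1≤k 1≤m clear P≐ Q≐ {y} y< {x} x<y =
    trans (glue-label 1≤k 1≤m v) (from-region v)
    where
    v : Region k m x y
    v = region x<y (≤-pred y<)
    from-region : (v : Region k m x y) → label (p 0 (k + m) , p 0 k , p k (k + m)) P Q v ≡ p x y
    from-region (inLeft (x<y , y≤k , ¬base)) = trans (P≐ (s≤s y≤k) x<y) (subclique-inner p 0 ¬base)
    from-region (leftBase refl refl) =
      trans (cong (p 0 k ⋆_) (trans (P≐ (n<1+n k) 1≤k) (subclique-base p 0 k))) (identityʳ _)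
    from-region (inRight x′ y′ refl refl (x′<y′ , y′≤m , ¬base)) = trans (Q≐ (s≤s y′≤m) x′<y′) (subclique-inner p k ¬base)
    from-region (rightBase refl refl) =
      trans (cong (p k (k + m) ⋆_) (trans (Q≐ (n<1+n m) 1≤m) (subclique-base p k m))) (identityʳ _)
    from-region (top refl refl) = refl
    from-region (across x<k k<y y≤ ¬top) = sym (clear x<k k<y y≤ ¬top)

  leaf-realizes : ∀ p → p 0 1 ≡ 𝟙 → ev leaf ≐[ 1 ] p
  leaf-realizes p p₀₁≡𝟙 = ≐ᵒ⇒≐ no-inner-arc (sym p₀₁≡𝟙)
    where
    no-inner-arc : unitC ≐ᵒ[ 1 ] p
    no-inner-arc (x<y , y≤1 , ¬base) =
      contradiction (n<1⇒n≡0 (<-≤-trans x<y y≤1) , ≤-antisym y≤1 (≤-trans (s≤s z≤n) x<y)) ¬base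

  Realization : ℕ → Clique → Set
  Realization n p = Σ Tree λ t → arity t ≡ n × ev t ≐[ n ] p

  realize′ : ∀ n → Acc _<_ n → 1 ≤ n → ∀ p → IsNCClique n p → Realization n p
  realize′ (suc zero) _ _ p (base-unit , _) = leaf , refl , leaf-realizes p (base-unit refl)
  realize′ (suc (suc j)) (acc smaller) _ p (_ , nc) =
    join (realize′ kˡ (smaller kˡ<N) 1≤kˡ (subclique p 0 kˡ) NCˡ)
         (realize′ kʳ (smaller kʳ<N) 1≤kʳ (subclique p kˡ kʳ) NCʳ)
    where
    N kˡ kʳ : ℕ
    N = suc (suc j)
    kˡ = lastSolid p (suc j)
    kʳ = N ∸ kˡ
    1≤kˡ : 1 ≤ kˡ
    1≤kˡ = lastSolid-pos p (suc j)
    kˡ<N : kˡ < N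
    kˡ<N = s≤s (lastSolid-≤ p (suc j) (s≤s z≤n))
    kˡ+kʳ≡N : kˡ + kʳ ≡ N
    kˡ+kʳ≡N = m+[n∸m]≡n (<⇒≤ kˡ<N)
    1≤kʳ : 1 ≤ kʳ
    1≤kʳ = m<n⇒0<n∸m kˡ<N
    kʳ<N : kʳ < N
    kʳ<N = ∸-monoʳ-< 1≤kˡ (<⇒≤ kˡ<N)
    NCˡ : IsNCClique kˡ (subclique p 0 kˡ)
    NCˡ = subclique-isNC p 0 (<⇒≤ kˡ<N) (λ (_ , kˡ≡N) → <⇒≢ kˡ<N kˡ≡N) nc
    NCʳ : IsNCClique kʳ (subclique p kˡ kʳ)
    NCʳ = subclique-isNC p kˡ (≤-reflexive kˡ+kʳ≡N) (λ (kˡ≡0 , _) → <⇒≢ 1≤kˡ (sym kˡ≡0)) nc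
    T : Triangle
    T = p 0 N , p 0 kˡ , p kˡ N
    join : Realization kˡ (subclique p 0 kˡ) → Realization kʳ (subclique p kˡ kʳ) → Realization N p
    join (l , l-arity , l≐) (r , r-arity , r≐) =
      node T l r ,
      trans (cong₂ _+_ l-arity r-arity) kˡ+kʳ≡N ,
      subst₂ (λ L R → glue T L R (ev l) (ev r) ≐[ N ] p) (sym l-arity) (sym r-arity)
             (glue-split p kˡ+kʳ≡N 1≤kˡ 1≤kʳ (lastSolid-clear p nc) l≐ r≐)

  realize : ∀ n → 1 ≤ n → ∀ p → IsNCClique n p → Realization n p
  realize n = realize′ n (<-wellFounded n)

  -- Rewriting by the relations

  infix 4 _⟶_ _~_

  data _⟶_ : Tree → Tree → Set where
    rule₁ : ∀ p₀ p₁ p₂ q₀ q₁ q₂ r₀ r₁ {A B C} → p₁ ⋆ q₀ ≡ r₁ ⋆ r₀ → ¬ (p₁ ⋆ q₀ ≡ 𝟙) →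
            node (p₀ , p₁ , p₂) (node (q₀ , q₁ , q₂) A B) C ⟶ node (p₀ , r₁ , p₂) (node (r₀ , q₁ , q₂) A B) C
    rule₂ : ∀ p₀ p₁ p₂ q₀ q₁ q₂ r₀ r₂ {A B C} → p₁ ⋆ q₀ ≡ 𝟙 → r₂ ⋆ r₀ ≡ 𝟙 →
            node (p₀ , p₁ , p₂) (node (q₀ , q₁ , q₂) A B) C ⟶ node (p₀ , q₁ , r₂) A (node (r₀ , q₂ , p₂) B C)
    rule₃ : ∀ p₀ p₁ p₂ q₀ q₁ q₂ r₀ r₂ {A B C} → p₂ ⋆ q₀ ≡ r₂ ⋆ r₀ → ¬ (p₂ ⋆ q₀ ≡ 𝟙) →
            node (p₀ , p₁ , p₂) A (node (q₀ , q₁ , q₂) B C) ⟶ node (p₀ , p₁ , r₂) A (node (r₀ , q₁ , q₂) B C)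
    congˡ : ∀ T {l l′} r → l ⟶ l′ → node T l r ⟶ node T l′ r
    congʳ : ∀ T l {r r′} → r ⟶ r′ → node T l r ⟶ node T l r′

  _~_ : Tree → Tree → Set
  _~_ = EqClosure _⟶_

  ~-congˡ : ∀ T {l l′} r → l ~ l′ → node T l r ~ node T l′ r
  ~-congˡ T r = gmap (λ l → node T l r) (congˡ T r)

  ~-congʳ : ∀ T l {r r′} → r ~ r′ → node T l r ~ node T l r′
  ~-congʳ T l = gmap (node T l) (congʳ T l)

  ⟶-arity : s ⟶ s′ → arity s ≡ arity s′
  ⟶-arity (rule₁ _ _ _ _ _ _ _ _ _ _) = refl
  ⟶-arity (rule₂ _ _ _ _ _ _ _ _ {A} {B} {C} _ _) = +-assoc (arity A) (arity B) (arity C)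
  ⟶-arity (rule₃ _ _ _ _ _ _ _ _ _ _) = refl
  ⟶-arity (congˡ _ r st) = cong (_+ arity r) (⟶-arity st)
  ⟶-arity (congʳ _ l st) = cong (arity l +_) (⟶-arity st)

  ⟶-ev : s ⟶ s′ → ev s ≐[ arity s ] ev s′
  ⟶-ev (rule₁ p₀ p₁ p₂ q₀ q₁ q₂ r₀ r₁ {A} {B} {C} e _) =
    glue-cong {P = ev q[A,B]} {P′ = ev r[A,B]} {Q = ev C} {Q′ = ev C} (arity-pos q[A,B]) (arity-pos C)
      (trans (cong (p₁ ⋆_) (ev-base q[A,B])) (trans e (cong (r₁ ⋆_) (sym (ev-base r[A,B])))))
      refl (glue-base-irrelevant {P = ev A} {Q = ev B} (arity-pos A) (arity-pos B)) (λ _ → refl)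
    where
    q[A,B] r[A,B] : Tree
    q[A,B] = node (q₀ , q₁ , q₂) A B
    r[A,B] = node (r₀ , q₁ , q₂) A B
  ⟶-ev (rule₂ _ _ _ _ _ _ _ _ {A} {B} {C} e₁ e₂) =
    glue-assoc {A = ev A} {B = ev B} {C = ev C} (arity-pos A) (arity-pos B) (arity-pos C) e₁ e₂
  ⟶-ev (rule₃ p₀ p₁ p₂ q₀ q₁ q₂ r₀ r₂ {A} {B} {C} e _) =
    glue-cong {P = ev A} {P′ = ev A} {Q = ev q[B,C]} {Q′ = ev r[B,C]} (arity-pos A) (arity-pos q[B,C]) refl
      (trans (cong (p₂ ⋆_) (ev-base q[B,C])) (trans e (cong (r₂ ⋆_) (sym (ev-base r[B,C])))))
      (λ _ → refl) (glue-base-irrelevant {P = ev B} {Q = ev C} (arity-pos B) (arity-pos C))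
    where
    q[B,C] r[B,C] : Tree
    q[B,C] = node (q₀ , q₁ , q₂) B C
    r[B,C] = node (r₀ , q₁ , q₂) B C
  ⟶-ev (congˡ (a , b , c) {l} r st) = glue-congˡ {Q = ev r} (⟶-arity st) (arity-pos l) (arity-pos r) (⟶-ev st)
  ⟶-ev (congʳ (a , b , c) l {r} st) = glue-congʳ {P = ev l} (⟶-arity st) (arity-pos l) (arity-pos r) (⟶-ev st)

  ⟶-ev-at : s ⟶ s′ → arity s ≡ n → ev s ≐[ n ] ev s′
  ⟶-ev-at st refl = ⟶-ev st

  infix 4 _≐ₐ_
  _≐ₐ_ : ℕ × Clique → ℕ × Clique → Set
  (n , P) ≐ₐ (m , Q) = n ≡ m × P ≐[ n ] Q

  ≐ₐ-isEquivalence : IsEquivalence _≐ₐ_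
  ≐ₐ-isEquivalence = record
    { refl  = λ { {n , P} → refl , ≐-refl {P = P} }
    ; sym   = λ { {n , P} {_ , Q} (refl , eq) → refl , ≐-sym {P = P} {Q = Q} eq }
    ; trans = λ { {n , P} {_ , Q} {_ , P′} (refl , eq) (refl , eq′) → refl , ≐-trans {P = P} {Q = Q} {P′ = P′} eq eq′ }
    }

  ~-arity-ev : s ~ s′ → (arity s , ev s) ≐ₐ (arity s′ , ev s′)
  ~-arity-ev = gfold ≐ₐ-isEquivalence (λ t → arity t , ev t) (λ st → ⟶-arity st , ⟶-ev st)

  ~-arity : s ~ s′ → arity s ≡ arity s′
  ~-arity s~s′ = proj₁ (~-arity-ev s~s′)

  ~-ev : s ~ s′ → ev s ≐[ arity s ] ev s′
  ~-ev s~s′ = proj₂ (~-arity-ev s~s′)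

  ~-ev-at : s ~ s′ → arity s ≡ n → ev s ≐[ n ] ev s′
  ~-ev-at s~s′ refl = ~-ev s~s′

  graft-⟶ : ∀ t {i} → i < arity t → s ⟶ s′ → graft t i s ⟶ graft t i s′
  graft-⟶ leaf {zero} _ st = st
  graft-⟶ leaf {suc _} (s≤s ()) _
  graft-⟶ (node T l r) {i} i<n st with i <? arity l
  ... | yes i<L rewrite <ᵇ-true i<L = congˡ T r (graft-⟶ l i<L st)
  ... | no i≮L rewrite <ᵇ-false (≮⇒≥ i≮L) = congʳ T l (graft-⟶ r (∸-<-cancelˡ (≮⇒≥ i≮L) i<n) st)

  ⟶-graft : ∀ i t → s ⟶ s′ → graft s i t ⟶ graft s′ i t
  ⟶-graft i t (congˡ T {l} {l′} r st) rewrite ⟶-arity st with i <ᵇ arity l′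
  ... | true = congˡ T r (⟶-graft i t st)
  ... | false = congˡ T _ st
  ⟶-graft i t (congʳ T l st) with i <ᵇ arity l
  ... | true = congʳ T _ st
  ... | false = congʳ T l (⟶-graft (i ∸ arity l) t st)
  ⟶-graft i t (rule₁ p₀ p₁ p₂ q₀ q₁ q₂ r₀ r₁ {A} {B} e ¬𝟙) with i <ᵇ arity A + arity B
  ... | false = rule₁ p₀ p₁ p₂ q₀ q₁ q₂ r₀ r₁ e ¬𝟙
  ... | true with i <ᵇ arity A
  ...   | true = rule₁ p₀ p₁ p₂ q₀ q₁ q₂ r₀ r₁ e ¬𝟙
  ...   | false = rule₁ p₀ p₁ p₂ q₀ q₁ q₂ r₀ r₁ e ¬𝟙
  ⟶-graft i t (rule₃ p₀ p₁ p₂ q₀ q₁ q₂ r₀ r₂ {A} {B} e ¬𝟙) with i <ᵇ arity A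
  ... | true = rule₃ p₀ p₁ p₂ q₀ q₁ q₂ r₀ r₂ e ¬𝟙
  ... | false with i ∸ arity A <ᵇ arity B
  ...   | true = rule₃ p₀ p₁ p₂ q₀ q₁ q₂ r₀ r₂ e ¬𝟙
  ...   | false = rule₃ p₀ p₁ p₂ q₀ q₁ q₂ r₀ r₂ e ¬𝟙
  ⟶-graft i t (rule₂ p₀ p₁ p₂ q₀ q₁ q₂ r₀ r₂ {A} {B} e₁ e₂) with i <? arity A | i <? arity A + arity B
  ... | yes i<A | _ rewrite <ᵇ-true (<-≤-trans i<A (m≤m+n (arity A) (arity B))) | <ᵇ-true i<A =
    rule₂ p₀ p₁ p₂ q₀ q₁ q₂ r₀ r₂ e₁ e₂
  ... | no i≮A | yes i<A+B
    rewrite <ᵇ-true i<A+B | <ᵇ-false (≮⇒≥ i≮A) | <ᵇ-true (∸-<-cancelˡ (≮⇒≥ i≮A) i<A+B) =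
    rule₂ p₀ p₁ p₂ q₀ q₁ q₂ r₀ r₂ e₁ e₂
  ... | no i≮A | no i≮A+B
    rewrite <ᵇ-false (≮⇒≥ i≮A+B) | <ᵇ-false (≮⇒≥ i≮A)
          | <ᵇ-false (m+n≤o⇒m≤o∸n (arity B) (subst (_≤ i) (+-comm (arity A) (arity B)) (≮⇒≥ i≮A+B)))
          | ∸-+-assoc i (arity A) (arity B) =
    rule₂ p₀ p₁ p₂ q₀ q₁ q₂ r₀ r₂ e₁ e₂

  suc-arity-graft : ∀ s {i} t → i < arity s → suc (arity (graft s i t)) ≡ arity s + arity t
  suc-arity-graft leaf {zero} t _ = refl
  suc-arity-graft leaf {suc _} t (s≤s ())
  suc-arity-graft (node T l r) {i} t i<n with i <? arity l
  ... | yes i<L rewrite <ᵇ-true i<L = begin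
    suc (arity (graft l i t) + arity r)  ≡⟨ cong (_+ arity r) (suc-arity-graft l t i<L) ⟩
    arity l + arity t + arity r          ≡⟨ +-assoc (arity l) (arity t) (arity r) ⟩
    arity l + (arity t + arity r)        ≡⟨ cong (arity l +_) (+-comm (arity t) (arity r)) ⟩
    arity l + (arity r + arity t)        ≡⟨ +-assoc (arity l) (arity r) (arity t) ⟨
    arity l + arity r + arity t          ∎
    where open ≡-Reasoning
  ... | no i≮L rewrite <ᵇ-false (≮⇒≥ i≮L) = begin
    suc (arity l + arity (graft r (i ∸ arity l) t))  ≡⟨ +-suc (arity l) _ ⟨
    arity l + suc (arity (graft r (i ∸ arity l) t))  ≡⟨ cong (arity l +_) (suc-arity-graft r t (∸-<-cancelˡ (≮⇒≥ i≮L) i<n)) ⟩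
    arity l + (arity r + arity t)                    ≡⟨ +-assoc (arity l) (arity r) (arity t) ⟨
    arity l + arity r + arity t                      ∎
    where open ≡-Reasoning

  arity-graft : ∀ s {i} t → i < arity s → arity (graft s i t) ≡ arity s + arity t ∸ 1
  arity-graft s t i<n = cong (_∸ 1) (suc-arity-graft s t i<n)

  -- Linear combinations of trees

  module F = Field K
  open F using () renaming (Carrier to 𝕂; _+_ to _+K_; _*_ to _*K_; -_ to -K_; _-_ to _-K_)
  private
    module AG = Algebra.Properties.AbelianGroup F.+-abelianGroup
    module CS = Algebra.Properties.CommutativeSemigroup F.+-commutativeSemigroup
    module RP = Algebra.Properties.Ring F.ring
    module ≈-Reasoning = Relation.Binary.Reasoning.Setoid F.setoid

  -- the total coefficient of the trees satisfying χ; coeffT and coeffC are instances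
  mass : (Tree → Bool) → Comb → 𝕂
  mass χ x = sumK (map (λ at → if χ (proj₂ at) then proj₁ at else 0#) x)

  δ : Bool → 𝕂
  δ b = if b then 1# else 0#

  mapTrees : (Tree → Tree) → Comb → Comb
  mapTrees f = map (λ at → proj₁ at , f (proj₂ at))

  if-cong : ∀ b {k k′} → k ≈ k′ → (if b then k else 0#) ≈ (if b then k′ else 0#)
  if-cong true k≈k′ = k≈k′
  if-cong false _ = F.refl

  if-scale : ∀ b k a → (if b then k *K a else 0#) ≈ k *K (if b then a else 0#)
  if-scale true k a = F.refl
  if-scale false k a = F.sym (F.zeroʳ k)

  if≈*δ : ∀ b k → (if b then k else 0#) ≈ k *K δ b
  if≈*δ true k = F.sym (F.*-identityʳ k)
  if≈*δ false k = F.sym (F.zeroʳ k)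

  a-b+b≈a : ∀ a b → (a -K b) +K b ≈ a
  a-b+b≈a a b = F.trans (F.+-assoc a (-K b) b) (F.trans (F.+-congˡ (F.-‿inverseˡ b)) (F.+-identityʳ a))

  mass-++ : ∀ χ x y → mass χ (x ++ y) ≈ mass χ x +K mass χ y
  mass-++ χ [] y = F.sym (F.+-identityˡ _)
  mass-++ χ (_ ∷ x) y = F.trans (F.+-congˡ (mass-++ χ x y)) (F.sym (F.+-assoc _ _ _))

  mass-scale : ∀ χ k x → mass χ (scaleF k x) ≈ k *K mass χ x
  mass-scale χ k [] = F.sym (F.zeroʳ k)
  mass-scale χ k ((a , t) ∷ x) = F.trans (F.+-cong (if-scale (χ t) k a) (mass-scale χ k x)) (F.sym (F.distribˡ k _ _))

  mass-mapTrees : ∀ χ f x → mass χ (mapTrees f x) ≡ mass (χ ∘ f) x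
  mass-mapTrees χ f [] = refl
  mass-mapTrees χ f (_ ∷ x) = cong (_ +K_) (mass-mapTrees χ f x)

  mass-congᴬ : ∀ χ χ′ x → All (λ at → χ (proj₂ at) ≡ χ′ (proj₂ at)) x → mass χ x ≡ mass χ′ x
  mass-congᴬ χ χ′ [] [] = refl
  mass-congᴬ χ χ′ ((k , t) ∷ x) (e ∷ es) = cong₂ (λ b m → (if b then k else 0#) +K m) e (mass-congᴬ χ χ′ x es)

  mass-vanishing : ∀ χ x → All (λ at → χ (proj₂ at) ≡ false) x → mass χ x ≈ 0#
  mass-vanishing χ x χ≡false = F.trans (F.reflexive (mass-congᴬ χ (λ _ → false) x χ≡false)) (none x)
    where
    none : ∀ x → mass (λ _ → false) x ≈ 0#
    none [] = F.refl
    none (_ ∷ x) = F.trans (F.+-identityˡ _) (none x)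

  mass-− : ∀ χ s t → mass χ (s − t) ≈ δ (χ s) -K δ (χ t)
  mass-− χ s t = F.+-congˡ (F.trans (F.+-identityʳ _) (neg-δ (χ t)))
    where
    neg-δ : ∀ b → (if b then -K 1# else 0#) ≈ -K δ b
    neg-δ true = F.refl
    neg-δ false = F.sym RP.-0#≈0#

  mass-−-self : ∀ χ s → mass χ (s − s) ≈ 0#
  mass-−-self χ s = F.trans (mass-− χ s s) (F.-‿inverseʳ _)

  mass-−-flip : ∀ χ s t → mass χ (scaleF (-K 1#) (s − t)) ≈ mass χ (t − s)
  mass-−-flip χ s t = begin
    mass χ (scaleF (-K 1#) (s − t))  ≈⟨ mass-scale χ (-K 1#) (s − t) ⟩
    -K 1# *K mass χ (s − t)          ≈⟨ RP.-1*x≈-x _ ⟩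
    -K mass χ (s − t)                ≈⟨ F.-‿cong (mass-− χ s t) ⟩
    -K (δ (χ s) -K δ (χ t))          ≈⟨ AG.⁻¹-anti-homo‿- _ _ ⟩
    δ (χ t) -K δ (χ s)               ≈⟨ mass-− χ t s ⟨
    mass χ (t − s)                   ∎
    where open ≈-Reasoning

  mass-−-chain : ∀ χ s t u → mass χ ((s − t) ++ (t − u)) ≈ mass χ (s − u)
  mass-−-chain χ s t u = begin
    mass χ ((s − t) ++ (t − u))        ≈⟨ mass-++ χ (s − t) (t − u) ⟩
    mass χ (s − t) +K mass χ (t − u)   ≈⟨ F.+-cong (mass-− χ s t) (mass-− χ t u) ⟩
    (δs -K δt) +K (δt -K δu)           ≈⟨ F.+-assoc _ _ _ ⟨
    ((δs -K δt) +K δt) -K δu           ≈⟨ F.+-congʳ (a-b+b≈a δs δt) ⟩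
    δs -K δu                           ≈⟨ mass-− χ s u ⟨
    mass χ (s − u)                     ∎
    where
    open ≈-Reasoning
    δs δt δu : 𝕂
    δs = δ (χ s)
    δt = δ (χ t)
    δu = δ (χ u)

  sumK-cong : ∀ {A : Set} {f g : A → 𝕂} (U : List A) → (∀ a → f a ≈ g a) → sumK (map f U) ≈ sumK (map g U)
  sumK-cong [] _ = F.refl
  sumK-cong (a ∷ U) f≈g = F.+-cong (f≈g a) (sumK-cong U f≈g)

  sumK-+ : ∀ {A : Set} (f g : A → 𝕂) (U : List A) →
           sumK (map (λ a → f a +K g a) U) ≈ sumK (map f U) +K sumK (map g U)
  sumK-+ f g [] = F.sym (F.+-identityˡ 0#)
  sumK-+ f g (a ∷ U) = F.trans (F.+-congˡ (sumK-+ f g U)) (CS.interchange _ _ _ _)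

  sumK-zero : ∀ {A : Set} {f : A → 𝕂} (U : List A) → All (λ a → f a ≈ 0#) U → sumK (map f U) ≈ 0#
  sumK-zero [] [] = F.refl
  sumK-zero (a ∷ U) (fa≈0 ∷ zeros) = F.trans (F.+-cong fa≈0 (sumK-zero U zeros)) (F.+-identityˡ 0#)

  point-on : ∀ (g : Tree → 𝕂) t → (if does (t ≟T t) then g t else 0#) ≈ g t
  point-on g t rewrite dec-true (t ≟T t) refl = F.refl

  point-off : ∀ (g : Tree → 𝕂) {t u} → ¬ t ≡ u → (if does (t ≟T u) then g u else 0#) ≈ 0#
  point-off g {t} {u} t≢u rewrite dec-false (t ≟T u) t≢u = F.refl

  sum-point : ∀ (g : Tree → 𝕂) {t} (U : List Tree) → Unique U → t ∈ U →
              sumK (map (λ u → if does (t ≟T u) then g u else 0#) U) ≈ g t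
  sum-point g {t} (t ∷ U) (t∉U ∷ _) (here refl) =
    F.trans (F.+-cong (point-on g t) (sumK-zero U (All.map (point-off g) t∉U))) (F.+-identityʳ _)
  sum-point g (u ∷ U) (u∉U ∷ unique) (there t∈U) =
    F.trans (F.+-cong (point-off g (λ t≡u → All.lookup u∉U t∈U (sym t≡u))) (sum-point g U unique t∈U)) (F.+-identityˡ _)

  if-split : ∀ b d {k c : 𝕂} →
             (if b then (if d then k else 0#) +K c else 0#) ≈ (if d then (if b then k else 0#) else 0#) +K (if b then c else 0#)
  if-split true _ = F.refl
  if-split false true = F.sym (F.+-identityˡ 0#)
  if-split false false = F.sym (F.+-identityˡ 0#)

  mass-over : ∀ χ x (U : List Tree) → Unique U → All (_∈ U) (map proj₂ x) →
              mass χ x ≈ sumK (map (λ u → if χ u then coeffT u x else 0#) U)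
  mass-over χ [] U _ [] = F.sym (sumK-zero U (All.tabulate (λ {u} _ → if-0 (χ u))))
    where
    if-0 : ∀ b → (if b then 0# else 0#) ≈ 0#
    if-0 true = F.refl
    if-0 false = F.refl
  mass-over χ ((k , t) ∷ x) U unique (t∈U ∷ x⊆U) = F.sym (begin
    sumK (map (λ u → if χ u then coeffT u ((k , t) ∷ x) else 0#) U)
      ≈⟨ sumK-cong U (λ u → if-split (χ u) (does (t ≟T u))) ⟩
    sumK (map (λ u → (if does (t ≟T u) then g u else 0#) +K (if χ u then coeffT u x else 0#)) U)
      ≈⟨ sumK-+ _ _ U ⟩
    sumK (map (λ u → if does (t ≟T u) then g u else 0#) U) +K sumK (map (λ u → if χ u then coeffT u x else 0#) U)
      ≈⟨ F.+-cong (sum-point g U unique t∈U) (F.sym (mass-over χ x U unique x⊆U)) ⟩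
    g t +K mass χ x ∎)
    where
    open ≈-Reasoning
    g : Tree → 𝕂
    g u = if χ u then k else 0#

  mass-resp : ∀ χ {x y} → x ≈F y → mass χ x ≈ mass χ y
  mass-resp χ {x} {y} x≈y = begin
    mass χ x                                              ≈⟨ mass-over χ x U unique (All.tabulate (covers ∘ ∈-++⁺ˡ)) ⟩
    sumK (map (λ u → if χ u then coeffT u x else 0#) U)  ≈⟨ sumK-cong U (λ u → if-cong (χ u) (x≈y u)) ⟩
    sumK (map (λ u → if χ u then coeffT u y else 0#) U)  ≈⟨ mass-over χ y U unique (All.tabulate (covers ∘ ∈-++⁺ʳ _)) ⟨
    mass χ y                                              ∎
    where
    open ≈-Reasoning
    U : List Tree
    U = deduplicate _≟T_ (map proj₂ x ++ map proj₂ y)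
    unique : Unique U
    unique = deduplicate-! _≟T_ _
    covers : ∀ {t} → t ∈ map proj₂ x ++ map proj₂ y → t ∈ U
    covers = ∈-deduplicate⁺ _≟T_

  diffs : (Tree → Tree) → Comb → Comb
  diffs f [] = []
  diffs f ((k , t) ∷ x) = scaleF k (t − f t) ++ diffs f x

  mass-diffs : ∀ χ f x → mass χ (diffs f x) +K mass (χ ∘ f) x ≈ mass χ x
  mass-diffs χ f [] = F.+-identityˡ 0#
  mass-diffs χ f ((k , t) ∷ x) = begin
    mass χ (scaleF k (t − f t) ++ diffs f x) +K ((if χ (f t) then k else 0#) +K mass (χ ∘ f) x)
      ≈⟨ F.+-cong (mass-++ χ (scaleF k (t − f t)) (diffs f x)) (F.+-congʳ (if≈*δ (χ (f t)) k)) ⟩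
    (mass χ (scaleF k (t − f t)) +K mass χ (diffs f x)) +K (k *K δ (χ (f t)) +K mass (χ ∘ f) x)
      ≈⟨ CS.interchange _ _ _ _ ⟩
    (mass χ (scaleF k (t − f t)) +K k *K δ (χ (f t))) +K (mass χ (diffs f x) +K mass (χ ∘ f) x)
      ≈⟨ F.+-cong telescope (mass-diffs χ f x) ⟩
    k *K δ (χ t) +K mass χ x
      ≈⟨ F.+-congʳ (if≈*δ (χ t) k) ⟨
    (if χ t then k else 0#) +K mass χ x ∎
    where
    open ≈-Reasoning
    telescope : mass χ (scaleF k (t − f t)) +K k *K δ (χ (f t)) ≈ k *K δ (χ t)
    telescope = begin
      mass χ (scaleF k (t − f t)) +K k *K δ (χ (f t))  ≈⟨ F.+-congʳ (F.trans (mass-scale χ k (t − f t)) (F.*-congˡ (mass-− χ t (f t)))) ⟩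
      k *K (δ (χ t) -K δ (χ (f t))) +K k *K δ (χ (f t)) ≈⟨ F.distribˡ k _ _ ⟨
      k *K ((δ (χ t) -K δ (χ (f t))) +K δ (χ (f t)))   ≈⟨ F.*-congˡ (a-b+b≈a _ _) ⟩
      k *K δ (χ t)                                     ∎

  -- The ideal lies in the kernel of evaluation

  Invariant : ℕ → (Tree → Bool) → Set
  Invariant n χ = ∀ {s s′} → s ⟶ s′ → arity s ≡ n → χ s ≡ χ s′

  mass-−-invariant : ∀ χ {s t} → χ s ≡ χ t → mass χ (s − t) ≈ 0#
  mass-−-invariant χ {s} {t} χs≡χt =
    F.trans (mass-− χ s t) (F.trans (F.+-congˡ (F.-‿cong (F.reflexive (cong δ (sym χs≡χt))))) (F.-‿inverseʳ _))

  relGen-massless : ∀ {x} → RelGen x → ∀ χ → Invariant 3 χ → mass χ x ≈ 0#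
  relGen-massless (rel1 p₀ p₁ p₂ q₀ q₁ q₂ r₀ r₁ e ¬𝟙) χ inv =
    mass-−-invariant χ (inv (rule₁ p₀ p₁ p₂ q₀ q₁ q₂ r₀ r₁ e ¬𝟙) refl)
  relGen-massless (rel2 p₀ p₁ p₂ q₀ q₁ q₂ r₀ r₂ e₁ e₂) χ inv =
    mass-−-invariant χ (inv (rule₂ p₀ p₁ p₂ q₀ q₁ q₂ r₀ r₂ e₁ e₂) refl)
  relGen-massless (rel3 p₀ p₁ p₂ q₀ q₁ q₂ r₀ r₂ e ¬𝟙) χ inv =
    mass-−-invariant χ (inv (rule₃ p₀ p₁ p₂ q₀ q₁ q₂ r₀ r₂ e ¬𝟙) refl)

  ideal-massless : ∀ {n x} → InIdeal n x → ∀ χ → Invariant n χ → mass χ x ≈ 0#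
  ideal-massless (gen g) χ inv = relGen-massless g χ inv
  ideal-massless zero χ inv = F.refl
  ideal-massless (add {x = x} {y} x∈I y∈I) χ inv =
    F.trans (mass-++ χ x y) (F.trans (F.+-cong (ideal-massless x∈I χ inv) (ideal-massless y∈I χ inv)) (F.+-identityˡ 0#))
  ideal-massless (scale {x = x} k x∈I) χ inv =
    F.trans (mass-scale χ k x) (F.trans (F.*-congˡ (ideal-massless x∈I χ inv)) (F.zeroʳ k))
  ideal-massless (resp {x = x} {y} x≈y x∈I) χ inv = F.trans (F.sym (mass-resp χ {x} {y} x≈y)) (ideal-massless x∈I χ inv)
  ideal-massless (compL {m} {x} t i i<t x∈I) χ inv =
    F.trans (F.reflexive (mass-mapTrees χ (graft t i) x)) (ideal-massless x∈I (χ ∘ graft t i) inv′)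
    where
    inv′ : Invariant m (χ ∘ graft t i)
    inv′ {s} st refl = inv (graft-⟶ t i<t st) (arity-graft t s i<t)
  ideal-massless (compR {n} {x} t i i<n x∈I) χ inv =
    F.trans (F.reflexive (mass-mapTrees χ (λ s → graft s i t) x)) (ideal-massless x∈I (λ s → χ (graft s i t)) inv′)
    where
    inv′ : Invariant n (λ s → χ (graft s i t))
    inv′ {s} st refl = inv (⟶-graft i t st) (arity-graft s t i<n)

  evClass : ℕ → Clique → Tree → Bool
  evClass n p s = does (ev s ≐?[ n ] p)

  evClass-invariant : ∀ n p → Invariant n (evClass n p)
  evClass-invariant n p {s} {s′} st s-arity =
    does-⇔ (mk⇔ (≐-trans (≐-sym s≐s′)) (≐-trans s≐s′)) (ev s ≐?[ n ] p) (ev s′ ≐?[ n ] p)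
    where
    s≐s′ : ev s ≐[ n ] ev s′
    s≐s′ = ⟶-ev-at st s-arity

  ideal⇒kernel : ∀ {n x} → InIdeal n x → ∀ p → coeffC n p x ≈ 0#
  ideal⇒kernel {n} x∈I p = ideal-massless x∈I (evClass n p) (evClass-invariant n p)

  -- Normal forms

  clearBase : Tree → Tree
  clearBase leaf = leaf
  clearBase (node (_ , b , c) l r) = node (𝟙 , b , c) l r

  nfNode : Elt → Elt → Elt → Tree → Tree → Tree
  nfNode a b c leaf r = node (a , b , c) leaf r
  nfNode a b c (node (a′ , b′ , c′) l′ r′) r with b ⋆ a′ FinP.≟ 𝟙
  ... | yes _ = node (a , b′ , 𝟙) l′ (nfNode 𝟙 c′ c r′ r)
  ... | no _ = node (a , b ⋆ a′ , c) (node (𝟙 , b′ , c′) l′ r′) r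

  norm : Tree → Tree
  norm leaf = leaf
  norm (node (a , b , c) l r) = nfNode a b (c ⋆ base (norm r)) (norm l) (clearBase (norm r))

  clearBase-~ : ∀ a b c l r → node (a , b , c) l r ~ node (a , b , c ⋆ base r) l (clearBase r)
  clearBase-~ a b c l leaf rewrite identityʳ c = ε
  clearBase-~ a b c l (node (a′ , b′ , c′) l′ r′) with c ⋆ a′ FinP.≟ 𝟙
  ... | no c⋆a′≢𝟙 = fwd (rule₃ a b c a′ b′ c′ 𝟙 (c ⋆ a′) (sym (identityʳ _)) c⋆a′≢𝟙) ◅ ε
  -- relation (3) does not apply; pass through the tree that both sides rotate to under relation (2)
  ... | yes c⋆a′≡𝟙 =
    bwd (rule₂ a 𝟙 c′ 𝟙 b b′ a′ c (identityˡ 𝟙) c⋆a′≡𝟙) ◅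
    fwd (rule₂ a 𝟙 c′ 𝟙 b b′ 𝟙 (c ⋆ a′) (identityˡ 𝟙) (trans (identityʳ _) c⋆a′≡𝟙)) ◅ ε

  nfNode-~ : ∀ a b c l r → node (a , b , c) l r ~ nfNode a b c l r
  nfNode-~ a b c leaf r = ε
  nfNode-~ a b c (node (a′ , b′ , c′) l′ r′) r with b ⋆ a′ FinP.≟ 𝟙
  ... | yes b⋆a′≡𝟙 = fwd (rule₂ a b c a′ b′ c′ 𝟙 𝟙 b⋆a′≡𝟙 (identityˡ 𝟙)) ◅ ~-congʳ _ l′ (nfNode-~ 𝟙 c′ c r′ r)
  ... | no b⋆a′≢𝟙 = fwd (rule₁ a b c a′ b′ c′ 𝟙 (b ⋆ a′) (sym (identityʳ _)) b⋆a′≢𝟙) ◅ ε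

  norm-~ : ∀ t → t ~ norm t
  norm-~ leaf = ε
  norm-~ (node (a , b , c) l r) =
    ~-congˡ _ r (norm-~ l) ◅◅ ~-congʳ _ (norm l) (norm-~ r) ◅◅
    clearBase-~ a b c (norm l) (norm r) ◅◅ nfNode-~ a b (c ⋆ base (norm r)) (norm l) (clearBase (norm r))

  -- The bases of the children are pushed onto the edges of the parent, and a left child hangs
  -- under an unlabelled edge only if it is a leaf: the root splits at the last solid arc out of 0.
  data NF : Tree → Set where
    nf-leaf : NF leaf
    nf-node : ∀ {a b c l r} → NF l → base l ≡ 𝟙 → NF r → base r ≡ 𝟙 → (b ≡ 𝟙 → l ≡ leaf) →
              NF (node (a , b , c) l r)

  clearBase-NF : ∀ {r} → NF r → NF (clearBase r)
  clearBase-NF nf-leaf = nf-leaf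
  clearBase-NF (nf-node lN lb rN rb b≡𝟙⇒leaf) = nf-node lN lb rN rb b≡𝟙⇒leaf

  clearBase-base : ∀ r → base (clearBase r) ≡ 𝟙
  clearBase-base leaf = refl
  clearBase-base (node _ _ _) = refl

  nfNode-base : ∀ a b c l r → base (nfNode a b c l r) ≡ a
  nfNode-base a b c leaf r = refl
  nfNode-base a b c (node (a′ , b′ , c′) l′ r′) r with b ⋆ a′ FinP.≟ 𝟙
  ... | yes _ = refl
  ... | no _ = refl

  nfNode-NF : ∀ a b c {l r} → NF l → NF r → base r ≡ 𝟙 → NF (nfNode a b c l r)
  nfNode-NF a b c nf-leaf rN rb = nf-node nf-leaf refl rN rb (λ _ → refl)
  nfNode-NF a b c {node (a′ , b′ , c′) l′ r′} {r} (nf-node l′N l′b r′N r′b b′≡𝟙⇒leaf) rN rb with b ⋆ a′ FinP.≟ 𝟙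
  ... | yes _ = nf-node l′N l′b (nfNode-NF 𝟙 c′ c r′N rN rb) (nfNode-base 𝟙 c′ c r′ r) b′≡𝟙⇒leaf
  ... | no b⋆a′≢𝟙 =
    nf-node (nf-node l′N l′b r′N r′b b′≡𝟙⇒leaf) refl rN rb (λ b⋆a′≡𝟙 → contradiction b⋆a′≡𝟙 b⋆a′≢𝟙)

  norm-NF : ∀ t → NF (norm t)
  norm-NF leaf = nf-leaf
  norm-NF (node (a , b , c) l r) =
    nfNode-NF a b (c ⋆ base (norm r)) (norm-NF l) (clearBase-NF (norm-NF r)) (clearBase-base (norm r))

  ⋆-unitʳ-cancel : ∀ {b b′ u u′} → u ≡ 𝟙 → u′ ≡ 𝟙 → b ⋆ u ≡ b′ ⋆ u′ → b ≡ b′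
  ⋆-unitʳ-cancel {b} {b′} refl refl e = trans (sym (identityʳ b)) (trans e (identityʳ b′))

  node-cong : ∀ {a b c a′ b′ c′ l r l′ r′} → a ≡ a′ → b ≡ b′ → c ≡ c′ → l ≡ l′ → r ≡ r′ →
              node (a , b , c) l r ≡ node (a′ , b′ , c′) l′ r′
  node-cong refl refl refl refl refl = refl

  node-≐-inv : ∀ {a b c a′ b′ c′ l r l′ r′} → arity l ≡ arity l′ → arity r ≡ arity r′ →
               ev (node (a , b , c) l r) ≐[ arity l + arity r ] ev (node (a′ , b′ , c′) l′ r′) →
               a ≡ a′ × b ⋆ ev l 0 (arity l) ≡ b′ ⋆ ev l′ 0 (arity l) × c ⋆ ev r 0 (arity r) ≡ c′ ⋆ ev r′ 0 (arity r) ×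
               ev l ≐ᵒ[ arity l ] ev l′ × ev r ≐ᵒ[ arity r ] ev r′
  node-≐-inv {a} {b} {c} {a′} {b′} {c′} {l} {r} {l′} {r′} L≡L′ R≡R′ eq =
    glue-≐-inv {P = ev l} {Q = ev r} {P′ = ev l′} {Q′ = ev r′} (arity-pos l) (arity-pos r)
      (subst₂ (λ L′ R′ → glue (a , b , c) (arity l) (arity r) (ev l) (ev r) ≐[ arity l + arity r ]
                         glue (a′ , b′ , c′) L′ R′ (ev l′) (ev r′))
              (sym L≡L′) (sym R≡R′) eq)

  NF-leftSplit-maximal : ∀ {a b c l r a′ b′ c′ l′ r′} → NF (node (a′ , b′ , c′) l′ r′) → arity l < arity l′ →
                         arity l + arity r ≡ arity l′ + arity r′ →
                         ¬ ev (node (a , b , c) l r) ≐[ arity l + arity r ] ev (node (a′ , b′ , c′) l′ r′)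
  NF-leftSplit-maximal {a} {b} {c} {l} {r} {a′} {b′} {c′} {l′} {r′} (nf-node _ l′b _ _ b′≡𝟙⇒leaf) L<L′ e eq =
    <⇒≱ (≤-<-trans (arity-pos l) L<L′) (≤-reflexive (cong arity (b′≡𝟙⇒leaf b′≡𝟙)))
    where
    L′<L+R : arity l′ < arity l + arity r
    L′<L+R = subst (arity l′ <_) (sym e) (m<m+n (arity l′) (arity-pos r′))
    b′≡𝟙 : b′ ≡ 𝟙
    b′≡𝟙 = begin
      b′                                          ≡⟨ identityʳ b′ ⟨
      b′ ⋆ 𝟙                                      ≡⟨ cong (b′ ⋆_) (trans (ev-base l′) l′b) ⟨
      b′ ⋆ ev l′ 0 (arity l′)                     ≡⟨ ev-label l′ r′ (leftBase refl refl) ⟨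
      ev (node (a′ , b′ , c′) l′ r′) 0 (arity l′) ≡⟨ eq (s≤s (<⇒≤ L′<L+R)) (arity-pos l′) ⟨
      ev (node (a , b , c) l r) 0 (arity l′)      ≡⟨ ev-label l r (across (arity-pos l) L<L′ (<⇒≤ L′<L+R) (λ (_ , e′) → <⇒≢ L′<L+R e′)) ⟩
      𝟙                                           ∎
      where open ≡-Reasoning

  NF-unique : ∀ {t t′} → NF t → NF t′ → arity t ≡ arity t′ → ev t ≐[ arity t ] ev t′ → t ≡ t′
  NF-unique nf-leaf nf-leaf _ _ = refl
  NF-unique nf-leaf (nf-node {l = l} {r} _ _ _ _ _) e _ = contradiction e (<⇒≢ (2≤arity-node l r))
  NF-unique (nf-node {l = l} {r} _ _ _ _ _) nf-leaf e _ = contradiction (sym e) (<⇒≢ (2≤arity-node l r))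
  NF-unique t@(nf-node {a} {b} {c} {l} {r} lN lb rN rb _) t′@(nf-node {a′} {b′} {c′} {l′} {r′} lN′ lb′ rN′ rb′ _) e eq
    with <-cmp (arity l) (arity l′)
  ... | tri< L<L′ _ _ = ⊥-elim (NF-leftSplit-maximal {a} {b} {c} {l} {r} t′ L<L′ e eq)
  ... | tri> _ _ L′<L = ⊥-elim (NF-leftSplit-maximal {a′} {b′} {c′} {l′} {r′} t L′<L (sym e) (≐-cast e (≐-sym eq)))
  ... | tri≈ _ L≡L′ _ with node-≐-inv {a} {b} {c} {a′} {b′} {c′} {l} {r} {l′} {r′} L≡L′ (+-cancelˡ-≡′ L≡L′ e) eq
  ...   | a≡a′ , eb , ec , eP , eQ =
    node-cong a≡a′ (⋆-unitʳ-cancel l-base l′-base eb) (⋆-unitʳ-cancel r-base r′-base ec)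
              (NF-unique lN lN′ L≡L′ (≐ᵒ⇒≐ eP (trans l-base (sym l′-base))))
              (NF-unique rN rN′ R≡R′ (≐ᵒ⇒≐ eQ (trans r-base (sym r′-base))))
    where
    R≡R′ : arity r ≡ arity r′
    R≡R′ = +-cancelˡ-≡′ L≡L′ e
    l-base : ev l 0 (arity l) ≡ 𝟙
    l-base = trans (ev-base l) lb
    l′-base : ev l′ 0 (arity l) ≡ 𝟙
    l′-base = trans (ev-base-at l′ (sym L≡L′)) lb′
    r-base : ev r 0 (arity r) ≡ 𝟙
    r-base = trans (ev-base r) rb
    r′-base : ev r′ 0 (arity r) ≡ 𝟙
    r′-base = trans (ev-base-at r′ (sym R≡R′)) rb′

  norm-arity : ∀ t → arity (norm t) ≡ arity t
  norm-arity t = sym (~-arity (norm-~ t))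

  norm-≡⇒ev-≐ : ∀ {n s t} → arity s ≡ n → arity t ≡ n → norm s ≡ norm t → ev s ≐[ n ] ev t
  norm-≡⇒ev-≐ {s = s} {t} s≡n t≡n ns≡nt =
    ≐-trans (subst (λ u → ev s ≐[ _ ] ev u) ns≡nt (~-ev-at (norm-~ s) s≡n)) (≐-sym (~-ev-at (norm-~ t) t≡n))

  ev-≐⇒norm-≡ : ∀ {n s t} → arity s ≡ n → arity t ≡ n → ev s ≐[ n ] ev t → norm s ≡ norm t
  ev-≐⇒norm-≡ {s = s} {t} s≡n t≡n s≐t =
    NF-unique (norm-NF s) (norm-NF t) (trans ns≡n (sym nt≡n))
      (≐-cast (sym ns≡n) (≐-trans (≐-sym (~-ev-at (norm-~ s) s≡n)) (≐-trans s≐t (~-ev-at (norm-~ t) t≡n))))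
    where
    ns≡n : arity (norm s) ≡ _
    ns≡n = trans (norm-arity s) s≡n
    nt≡n : arity (norm t) ≡ _
    nt≡n = trans (norm-arity t) t≡n

  -- The kernel of evaluation lies in the ideal

  -- the index is what the indices (n + arity t) ∸ 1 of the three compR steps reduce to
  plugLeaves : ∀ {x} A B C → InIdeal 3 x →
               InIdeal (arity C + arity B + arity A)
                       (mapTrees (λ s → graft s 0 A) (mapTrees (λ s → graft s 1 B) (mapTrees (λ s → graft s 2 C) x)))
  plugLeaves A B C x∈I = compR A 0 z<s (compR B 1 (s<s z<s) (compR C 2 (s<s (s<s z<s)) x∈I))

  graft-rightmost : ∀ T l s → graft (node T l leaf) (arity l) s ≡ node T l s
  graft-rightmost T l s rewrite <ᵇ-false (≤-refl {arity l}) | n∸n≡0 (arity l) = refl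

  InIdeal-cast : ∀ {m n x} → m ≡ n → InIdeal m x → InIdeal n x
  InIdeal-cast refl x∈I = x∈I

  ⟶-ideal : s ⟶ s′ → InIdeal (arity s) (s − s′)
  ⟶-ideal (rule₁ p₀ p₁ p₂ q₀ q₁ q₂ r₀ r₁ {A} {B} {C} e ¬𝟙) =
    InIdeal-cast (c+b+a≡a+b+c (arity A) (arity B) (arity C))
                 (plugLeaves A B C (gen (rel1 p₀ p₁ p₂ q₀ q₁ q₂ r₀ r₁ e ¬𝟙)))
  ⟶-ideal (rule₂ p₀ p₁ p₂ q₀ q₁ q₂ r₀ r₂ {A} {B} {C} e₁ e₂) =
    InIdeal-cast (c+b+a≡a+b+c (arity A) (arity B) (arity C))
                 (plugLeaves A B C (gen (rel2 p₀ p₁ p₂ q₀ q₁ q₂ r₀ r₂ e₁ e₂)))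
  ⟶-ideal (rule₃ p₀ p₁ p₂ q₀ q₁ q₂ r₀ r₂ {A} {B} {C} e ¬𝟙) =
    InIdeal-cast (trans (c+b+a≡a+b+c (arity A) (arity B) (arity C)) (+-assoc (arity A) (arity B) (arity C)))
                 (plugLeaves A B C (gen (rel3 p₀ p₁ p₂ q₀ q₁ q₂ r₀ r₂ e ¬𝟙)))
  ⟶-ideal (congˡ T {l} r st) =
    InIdeal-cast (+-comm (arity r) (arity l)) (compL (node T leaf r) 0 z<s (⟶-ideal st))
  ⟶-ideal (congʳ T l {r} {r′} st) =
    subst₂ InIdeal (trans (cong (_∸ 1) (+-assoc (arity l) 1 (arity r))) (cong (_∸ 1) (+-suc (arity l) (arity r))))
                   (cong₂ _−_ (graft-rightmost T l r) (graft-rightmost T l r′))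
                   (compL (node T l leaf) (arity l) (m<m+n (arity l) z<s) (⟶-ideal st))

  ~-ideal : s ~ s′ → InIdeal (arity s) (s − s′)
  ~-ideal {s} ε = resp (λ u → F.sym (mass-−-self (λ v → does (v ≟T u)) s)) zero
  ~-ideal {s} {s′} (_◅_ {j = t} (fwd st) t~s′) =
    resp (λ u → mass-−-chain (λ v → does (v ≟T u)) s t s′)
         (add (⟶-ideal st) (InIdeal-cast (sym (⟶-arity st)) (~-ideal t~s′)))
  ~-ideal {s} {s′} (_◅_ {j = t} (bwd st) t~s′) =
    resp (λ u → mass-−-chain (λ v → does (v ≟T u)) s t s′)
         (add (InIdeal-cast (⟶-arity st) t-s∈I)
              (InIdeal-cast (⟶-arity st) (~-ideal t~s′)))
    where
    t-s∈I : InIdeal (arity t) (s − t)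
    t-s∈I = resp (λ u → mass-−-flip (λ v → does (v ≟T u)) t s) (scale (-K 1#) (⟶-ideal st))

  diffs-ideal : ∀ {n x} → Homogeneous n x → InIdeal n (diffs norm x)
  diffs-ideal [] = zero
  diffs-ideal {x = (k , t) ∷ _} (t≡n ∷ hom) = add (scale k (InIdeal-cast t≡n (~-ideal (norm-~ t)))) (diffs-ideal hom)

  norms-vanish : ∀ {n x} → Homogeneous n x → (∀ p → coeffC n p x ≈ 0#) → mapTrees norm x ≈F []
  norms-vanish {n} {x} hom kernel u with any? (λ at → norm (proj₂ at) ≟T u) x
  ... | no none =
    F.trans (F.reflexive (mass-mapTrees χ norm x))
            (mass-vanishing (χ ∘ norm) x (All.map (λ {at} → dec-false (norm (proj₂ at) ≟T u)) (¬Any⇒All¬ x none)))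
    where
    χ : Tree → Bool
    χ v = does (v ≟T u)
  ... | yes some with All.lookupAny hom some
  ...   | t₀≡n , nt₀≡u =
    F.trans (F.reflexive (trans (mass-mapTrees χ norm x)
                                (mass-congᴬ (χ ∘ norm) (evClass n (ev t₀)) x (All.map (λ {at} → same-class {at}) hom))))
            (kernel (ev t₀))
    where
    χ : Tree → Bool
    χ v = does (v ≟T u)
    t₀ : Tree
    t₀ = proj₂ (Any.lookup some)
    same-class : ∀ {at} → arity (proj₂ at) ≡ n → χ (norm (proj₂ at)) ≡ evClass n (ev t₀) (proj₂ at)
    same-class {_ , s} s≡n = does-⇔ (mk⇔ to from) (norm s ≟T u) (ev s ≐?[ n ] ev t₀)
      where
      to : norm s ≡ u → ev s ≐[ n ] ev t₀
      to ns≡u = norm-≡⇒ev-≐ {s = s} {t₀} s≡n t₀≡n (trans ns≡u (sym nt₀≡u))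
      from : ev s ≐[ n ] ev t₀ → norm s ≡ u
      from s≐t₀ = trans (ev-≐⇒norm-≡ {s = s} {t₀} s≡n t₀≡n s≐t₀) nt₀≡u

  kernel⇒ideal : ∀ {n x} → Homogeneous n x → (∀ p → coeffC n p x ≈ 0#) → InIdeal n x
  kernel⇒ideal {n} {x} hom kernel = resp diffs≈x (diffs-ideal hom)
    where
    diffs≈x : diffs norm x ≈F x
    diffs≈x u = begin
      mass χ (diffs norm x)                             ≈⟨ F.+-identityʳ _ ⟨
      mass χ (diffs norm x) +K 0#                       ≈⟨ F.+-congˡ (norms-vanish hom kernel u) ⟨
      mass χ (diffs norm x) +K mass χ (mapTrees norm x) ≈⟨ F.+-congˡ (F.reflexive (mass-mapTrees χ norm x)) ⟩
      mass χ (diffs norm x) +K mass (χ ∘ norm) x        ≈⟨ mass-diffs χ norm x ⟩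
      mass χ x                                          ∎
      where
      open ≈-Reasoning
      χ : Tree → Bool
      χ v = does (v ≟T u)

  realize-comb : (n : ℕ) → 1 ≤ n → (p : Clique) → IsNCClique n p →
                 Σ Comb λ x → Homogeneous n x × (∀ q → coeffC n q x ≈ (if does (q ≐?[ n ] p) then 1# else 0#))
  realize-comb n 1≤n p ncp with realize n 1≤n p ncp
  ... | t , t-arity , t≐p =
    (1# , t) ∷ [] , t-arity ∷ [] ,
    λ q → F.trans (F.+-identityʳ _) (F.reflexive (cong δ (does-⇔ (mk⇔ (to q) (from q)) (ev t ≐?[ n ] q) (q ≐?[ n ] p))))
    where
    to : ∀ q → ev t ≐[ n ] q → q ≐[ n ] p
    to q t≐q = ≐-trans (≐-sym t≐q) t≐p
    from : ∀ q → q ≐[ n ] p → ev t ≐[ n ] q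
    from q q≐p = ≐-trans t≐p (≐-sym q≐p)

theorem3p15 : ∀ {c ℓ} (K : Field c ℓ) → CharacteristicZero K → (M : FiniteUnitaryMagma) →
    let open NC K M in ((t : Tree) → IsNCClique (arity t) (ev t))
       × ((n : ℕ) (x : Comb) → Homogeneous n x → (InIdeal n x ⇔ (∀ p → coeffC n p x ≈ 0#)))
       × ((n : ℕ) → 1 ≤ n → (p : Clique) → IsNCClique n p →
            Σ Comb λ x → Homogeneous n x ×
              (∀ q → coeffC n q x ≈ (if does (q ≐?[ n ] p) then 1# else 0#)))
theorem3p15 K _ M =
  ev-isNCClique , (λ n x hom → mk⇔ ideal⇒kernel (kernel⇒ideal hom)) , realize-comb
  where open Proof K M
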